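{- For all $n\ge 2$, $\overline{q}_n(132,321)=2n^2-3n+2$.
   Context: For a positive integer $n$, let $\mathcal{S}_{n,n}$ denote the set of all permutations (words) $\pi=\pi_1\cdots\pi_{2n}$ of the multiset $\{1,1,2,2,\ldots,n,n\}$. A word $\pi$ contains a pattern $\sigma=\sigma_1\cdots\sigma_k$ if there are indices $i_1<\cdots<i_k$ such that $\pi_{i_a}=\pi_{i_b}$ iff $\sigma_a=\sigma_b$ and $\pi_{i_a}<\pi_{i_b}$ iff $\sigma_a<\sigma_b$ for all $a,b$; otherwise $\pi$ avoids $\sigma$. The quasi-Stirling permutations $\overline{\mathcal{Q}}_n$ are the $\pi\in\mathcal{S}_{n,n}$ avoiding both $1212$ and $2121$. For a set $\Lambda$ of patterns, $\overline{\mathcal{Q}}_n(\Lambda)$ is the set of $\pi\in\overline{\mathcal{Q}}_n$ avoiding every pattern in $\Lambda$, and $\overline{q}_n(\Lambda)=|\overline{\mathcal{Q}}_n(\Lambda)|$. -}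

module Defs where

open import Data.Nat using (ℕ; suc; _<_)
open import Data.List using (List; []; _∷_; zip; concatMap; length; upTo; map)
open import Data.List.Membership.Propositional using (_∈_)
open import Data.List.Relation.Unary.All using (All)
open import Data.List.Relation.Binary.Permutation.Propositional using (_↭_)
open import Data.List.Relation.Binary.Sublist.Propositional using (_⊆_)
open import Data.List.Relation.Unary.Unique.Propositional using (Unique)
open import Data.Product using (Σ; ∃; _×_; _,_)
open import Function.Bundles using (_⇔_)
open import Relation.Binary.PropositionalEquality using (_≡_)
open import Relation.Nullary using (¬_)

Word : Set
Word = List ℕ

doubled : ℕ → List ℕ
doubled n = concatMap (λ i → suc i ∷ suc i ∷ []) (upTo n)

InSnn : ℕ → Word → Set
InSnn n π = π ↭ doubled n

-- s is order-isomorphic to σ: same length, and for all positions a, b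
-- s_a = s_b iff σ_a = σ_b, and s_a < s_b iff σ_a < σ_b.
-- (Ranging over all pairs of entries of  zip s σ  is ranging over all
-- pairs of positions (a , b).)
OrderIso : Word → Word → Set
OrderIso s σ =
  length s ≡ length σ ×
  (∀ {x y x′ y′} → (x , y) ∈ zip s σ → (x′ , y′) ∈ zip s σ →
     ((x ≡ x′) ⇔ (y ≡ y′)) × ((x < x′) ⇔ (y < y′)))

Contains : Word → Word → Set
Contains π σ = ∃ λ s → s ⊆ π × OrderIso s σ

Avoids : Word → Word → Set
Avoids π σ = ¬ Contains π σ

QuasiStirling : ℕ → Word → Set
QuasiStirling n π =
  InSnn n π × Avoids π (1 ∷ 2 ∷ 1 ∷ 2 ∷ []) × Avoids π (2 ∷ 1 ∷ 2 ∷ 1 ∷ [])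

QAvoid : ℕ → List Word → Word → Set
QAvoid n Λ π = QuasiStirling n π × All (Avoids π) Λ

HasCount : (Word → Set) → ℕ → Set
HasCount P k =
  Σ (List Word) λ L → Unique L × (∀ π → (π ∈ L) ⇔ P π) × length L ≡ k

module Submission where

-- Write π ∈ Q̄ₙ₊₁(132, 321) as X m Y m Z around its two largest letters m = n + 1. Then Y Z is
-- ascending (else m y z is a 321), X lies weakly above Y Z (else x m y is a 132), X and Y share no
-- letter (1212), and Y, Z are not both nonempty (their first letters would coincide: 2121). So
-- either Y = Z = ε and X ∈ Q̄ₙ(132, 321); or Y X, resp. Z X, is the sorted word 1 1 2 2 ⋯ n n, cut
-- between two pairs or (for Z) inside one; or 1 occurs in X, which forces Z = 1 and X = X₁ 1 X₂
-- with X₁ X₂ = 2 2 ⋯ n n cut between two pairs. Conversely all these words lie in Q̄ₙ₊₁(132, 321),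
-- they are told apart by their last two letters, and counting them gives q̄ₙ₊₁ = q̄ₙ + 4n − 1.

open import Defs
open import Data.Nat using (ℕ; zero; suc; _≤_; _<_; _+_; _*_; _∸_; _^_; z≤n; s≤s; _≟_)
open import Data.Nat.Properties
open import Data.Nat.Tactic.RingSolver using (solve-∀)
open import Data.List using (List; []; _∷_; _++_; [_]; map; length; zip; foldl; filter; concatMap; applyUpTo; upTo)
open import Data.List.Properties using (++-assoc; ++-identityʳ; ∷-injectiveˡ; ∷-injectiveʳ; filter-all; filter-none; filter-accept; filter-reject; length-map; foldl-++; ++-cancelʳ; length-++; length-upTo)
open import Data.List.Membership.Propositional using (_∈_; _∉_)
open import Data.List.Membership.Propositional.Properties using (∈-++⁺ˡ; ∈-++⁺ʳ; ∈-++⁻; ∈-∃++; ∈-map⁺; ∈-upTo⁺; ∈-upTo⁻)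
open import Data.List.Membership.DecPropositional _≟_ using (_∈?_)
open import Data.List.Relation.Unary.Any using (here; there)
open import Data.List.Relation.Unary.All using (All; []; _∷_)
import Data.List.Relation.Unary.All as All
import Data.List.Relation.Unary.All.Properties as All
open import Data.List.Relation.Unary.Unique.Propositional using (Unique)
import Data.List.Relation.Unary.Unique.Propositional.Properties as Unique
open import Data.List.Relation.Unary.AllPairs using ([]; _∷_)
open import Data.List.Relation.Unary.Linked using ([]; [-]; _∷_)
open import Data.List.Relation.Unary.Sorted.TotalOrder ≤-totalOrder using (Sorted)
open import Data.List.Relation.Unary.Sorted.TotalOrder.Properties using (↗↭↗⇒≋)
open import Data.List.Relation.Binary.Equality.Propositional using (≋⇒≡)
open import Data.List.Relation.Binary.Sublist.Propositional using (_⊆_; []; _∷_; _∷ʳ_; ⊆-refl; ⊆-trans; minimum; from∈; to∈)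
import Data.List.Relation.Binary.Sublist.Propositional.Properties as ⊆
open import Data.List.Relation.Binary.Permutation.Propositional using (_↭_; ↭-refl; ↭-sym; ↭-trans; ↭-reflexive; ↭⇒↭ₛ; module PermutationReasoning)
open import Data.List.Relation.Binary.Permutation.Propositional.Properties using (↭-length; filter-↭; ++-comm; shift; ++⁺ˡ; ∈-resp-↭; drop-mid; drop-∷; ↭-empty-inv)
open import Data.Product using (∃; ∃₂; _×_; _,_; proj₁; proj₂)
open import Data.Sum using (_⊎_; inj₁; inj₂)
open import Data.Empty using (⊥; ⊥-elim)
open import Function using (id)
open import Function.Bundles using (_⇔_; mk⇔; Equivalence)
import Function.Properties.Equivalence as ⇔
open import Relation.Binary.Definitions using (tri<; tri≈; tri>)
open import Relation.Nullary using (¬_; yes; no)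
open import Relation.Binary.PropositionalEquality using (_≡_; _≢_; refl; sym; trans; cong; cong₂; subst; module ≡-Reasoning)

doubledFrom : ℕ → ℕ → List ℕ
doubledFrom a zero = []
doubledFrom a (suc c) = suc a ∷ suc a ∷ doubledFrom (suc a) c

concatMap-applyUpTo : ∀ f a c → (∀ i → f i ≡ a + i) →
  concatMap (λ i → suc i ∷ suc i ∷ []) (applyUpTo f c) ≡ doubledFrom a c
concatMap-applyUpTo f a zero f≗a+ = refl
concatMap-applyUpTo f a (suc c) f≗a+ rewrite f≗a+ 0 | +-identityʳ a =
  cong (λ w → suc a ∷ suc a ∷ w)
    (concatMap-applyUpTo (λ i → f (suc i)) (suc a) c (λ i → trans (f≗a+ (suc i)) (+-suc a i)))

doubled≡doubledFrom : ∀ n → doubled n ≡ doubledFrom 0 n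
doubled≡doubledFrom n = concatMap-applyUpTo id 0 n (λ _ → refl)

doubledFrom-++ : ∀ a k c → doubledFrom a (k + c) ≡ doubledFrom a k ++ doubledFrom (a + k) c
doubledFrom-++ a zero c rewrite +-identityʳ a = refl
doubledFrom-++ a (suc k) c rewrite +-suc a k = cong (λ w → suc a ∷ suc a ∷ w) (doubledFrom-++ (suc a) k c)

doubledFrom-snoc : ∀ a c → doubledFrom a (suc c) ≡ doubledFrom a c ++ suc (a + c) ∷ suc (a + c) ∷ []
doubledFrom-snoc a c = trans (cong (doubledFrom a) (+-comm 1 c)) (doubledFrom-++ a c 1)

doubledFrom-bounds : ∀ {x} a c → x ∈ doubledFrom a c → a < x × x ≤ a + c
doubledFrom-bounds a (suc c) (here refl) = ≤-refl , ≤-trans (s≤s (m≤m+n a c)) (≤-reflexive (sym (+-suc a c)))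
doubledFrom-bounds a (suc c) (there (here refl)) = doubledFrom-bounds a (suc c) (here refl)
doubledFrom-bounds {x} a (suc c) (there (there x∈)) with doubledFrom-bounds (suc a) c x∈
... | a<x , x≤ = <-trans (n<1+n a) a<x , ≤-trans x≤ (≤-reflexive (sym (+-suc a c)))

doubledFrom-top : ∀ n → suc n ∈ doubledFrom 0 (suc n)
doubledFrom-top n rewrite doubledFrom-snoc 0 n = ∈-++⁺ʳ (doubledFrom 0 n) (here refl)

⊆-++-split : ∀ {s} (xs ys : List ℕ) → s ⊆ xs ++ ys →
  ∃₂ λ s₁ s₂ → s₁ ++ s₂ ≡ s × s₁ ⊆ xs × s₂ ⊆ ys
⊆-++-split [] ys s⊆ = [] , _ , refl , [] , s⊆
⊆-++-split (x ∷ xs) ys (.x ∷ʳ s⊆) with ⊆-++-split xs ys s⊆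
... | s₁ , s₂ , refl , s₁⊆ , s₂⊆ = s₁ , s₂ , refl , x ∷ʳ s₁⊆ , s₂⊆
⊆-++-split (x ∷ xs) ys (refl ∷ s⊆) with ⊆-++-split xs ys s⊆
... | s₁ , s₂ , refl , s₁⊆ , s₂⊆ = x ∷ s₁ , s₂ , refl , refl ∷ s₁⊆ , s₂⊆

∈-++-⊆ : ∀ {x : ℕ} {s xs ys} → x ∈ xs → s ⊆ ys → x ∷ s ⊆ xs ++ ys
∈-++-⊆ x∈ s⊆ = ⊆.++⁺ (from∈ x∈) s⊆

Ascending : List ℕ → Set
Ascending w = ∀ {a b} → a ∷ b ∷ [] ⊆ w → a ≤ b

ascending-⊆ : ∀ {s w} → s ⊆ w → Ascending w → Ascending s
ascending-⊆ s⊆w asc ab⊆s = asc (⊆-trans ab⊆s s⊆w)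

ascending-first : ∀ {x y s} → Ascending (x ∷ y ∷ s) → x ≤ y
ascending-first asc = asc (refl ∷ refl ∷ minimum _)

ascending-tail : ∀ {x xs} → Ascending (x ∷ xs) → Ascending xs
ascending-tail asc ab⊆ = asc (_ ∷ʳ ab⊆)

ascending-[] : Ascending []
ascending-[] ()

ascending-∷ : ∀ {x xs} → (∀ {y} → y ∈ xs → x ≤ y) → Ascending xs → Ascending (x ∷ xs)
ascending-∷ x≤ asc (_ ∷ʳ ab⊆) = asc ab⊆
ascending-∷ x≤ asc (refl ∷ b⊆) = x≤ (to∈ b⊆)

ascending-[x] : ∀ {x} → Ascending [ x ]
ascending-[x] = ascending-∷ (λ ()) ascending-[]

ascending-[x,x] : ∀ {x} → Ascending (x ∷ x ∷ [])
ascending-[x,x] = ascending-∷ (λ { (here refl) → ≤-refl }) ascending-[x]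

ascending-++ : ∀ {xs ys} → Ascending xs → Ascending ys → (∀ {x y} → x ∈ xs → y ∈ ys → x ≤ y) →
  Ascending (xs ++ ys)
ascending-++ {xs} {ys} ascx ascy x≤y ab⊆ with ⊆-++-split xs ys ab⊆
... | [] , _ , refl , _ , ab⊆ys = ascy ab⊆ys
... | _ ∷ [] , _ , refl , a⊆xs , b⊆ys = x≤y (to∈ a⊆xs) (to∈ b⊆ys)
... | _ ∷ _ ∷ [] , _ , refl , ab⊆xs , _ = ascx ab⊆xs

ascending-doubledFrom : ∀ a c → Ascending (doubledFrom a c)
ascending-doubledFrom a zero = ascending-[]
ascending-doubledFrom a (suc c) =
  ascending-∷ a+1≤ (ascending-∷ (λ x∈ → <⇒≤ (above x∈)) (ascending-doubledFrom (suc a) c))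
  where
  above : ∀ {x} → x ∈ doubledFrom (suc a) c → suc a < x
  above x∈ = proj₁ (doubledFrom-bounds (suc a) c x∈)
  a+1≤ : ∀ {x} → x ∈ suc a ∷ doubledFrom (suc a) c → suc a ≤ x
  a+1≤ (here refl) = ≤-refl
  a+1≤ (there x∈) = <⇒≤ (above x∈)

ascending⇒sorted : ∀ {w} → Ascending w → Sorted w
ascending⇒sorted {[]} _ = []
ascending⇒sorted {x ∷ []} _ = [-]
ascending⇒sorted {x ∷ y ∷ w} asc = ascending-first asc ∷ ascending⇒sorted (ascending-tail asc)

ascending-↭⇒≡ : ∀ {xs ys} → Ascending xs → Ascending ys → xs ↭ ys → xs ≡ ys
ascending-↭⇒≡ ascx ascy p = ≋⇒≡ (↗↭↗⇒≋ ≤-totalOrder (ascending⇒sorted ascx) (ascending⇒sorted ascy) (↭⇒↭ₛ p))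

occurrences : ℕ → List ℕ → ℕ
occurrences t w = length (filter (t ≟_) w)

occurrences-↭ : ∀ t {xs ys} → xs ↭ ys → occurrences t xs ≡ occurrences t ys
occurrences-↭ t p = ↭-length (filter-↭ (t ≟_) p)

occurrences-⊆ : ∀ t {xs ys} → xs ⊆ ys → occurrences t xs ≤ occurrences t ys
occurrences-⊆ t s⊆ = ⊆.length-mono-≤ (⊆.filter⁺ (t ≟_) (t ≟_) (λ { refl → id }) s⊆)

occurrences-doubledFrom : ∀ t a c → occurrences t (doubledFrom a c) ≤ 2
occurrences-doubledFrom t a zero = z≤n
occurrences-doubledFrom t a (suc c) with t ≟ suc a
... | yes refl
  rewrite filter-accept (t ≟_) {xs = t ∷ doubledFrom t c} refl
        | filter-accept (t ≟_) {xs = doubledFrom t c} refl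
        | filter-none (t ≟_) (All.tabulate (λ x∈ t≡x → <-irrefl t≡x (proj₁ (doubledFrom-bounds t c x∈))))
  = ≤-refl
... | no t≢a+1
  rewrite filter-reject (t ≟_) {xs = suc a ∷ doubledFrom (suc a) c} t≢a+1
        | filter-reject (t ≟_) {xs = doubledFrom (suc a) c} t≢a+1
  = occurrences-doubledFrom t (suc a) c

no-triple : ∀ {t w n} → w ↭ doubledFrom 0 n → ¬ (t ∷ t ∷ t ∷ [] ⊆ w)
no-triple {t} {w} {n} p ttt⊆ = <⇒≱ (s≤s ≤-refl) (begin
  3 ≡⟨ cong length (sym (filter-all (t ≟_) (refl ∷ refl ∷ refl ∷ []))) ⟩
  occurrences t (t ∷ t ∷ t ∷ []) ≤⟨ occurrences-⊆ t ttt⊆ ⟩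
  occurrences t w ≡⟨ occurrences-↭ t p ⟩
  occurrences t (doubledFrom 0 n) ≤⟨ occurrences-doubledFrom t 0 n ⟩
  2 ∎)
  where open ≤-Reasoning

Has132 Has321 : List ℕ → Set
Has132 π = ∃ λ a → ∃ λ b → ∃ λ c → a ∷ b ∷ c ∷ [] ⊆ π × a < c × c < b
Has321 π = ∃ λ a → ∃ λ b → ∃ λ c → a ∷ b ∷ c ∷ [] ⊆ π × c < b × b < a

Has1212 Has2121 : List ℕ → Set
Has1212 π = ∃ λ a → ∃ λ b → a ∷ b ∷ a ∷ b ∷ [] ⊆ π × a < b
Has2121 π = ∃ λ a → ∃ λ b → b ∷ a ∷ b ∷ a ∷ [] ⊆ π × a < b

zip-map-∈ : ∀ (f : ℕ → ℕ) σ {x y} → (x , y) ∈ zip (map f σ) σ → x ≡ f y × y ∈ σ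
zip-map-∈ f (s ∷ σ) (here refl) = refl , here refl
zip-map-∈ f (s ∷ σ) (there p) with zip-map-∈ f σ p
... | x≡fy , y∈ = x≡fy , there y∈

orderIso-map : ∀ (f : ℕ → ℕ) σ → (∀ {y y′} → y ∈ σ → y′ ∈ σ → y < y′ → f y < f y′) →
  OrderIso (map f σ) σ
orderIso-map f σ mono = length-map f σ , λ p q → iso (zip-map-∈ f σ p) (zip-map-∈ f σ q)
  where
  iso : ∀ {x y x′ y′} → x ≡ f y × y ∈ σ → x′ ≡ f y′ × y′ ∈ σ →
        ((x ≡ x′) ⇔ (y ≡ y′)) × ((x < x′) ⇔ (y < y′))
  iso {y = y} {y′ = y′} (refl , y∈) (refl , y′∈) = mk⇔ injective (cong f) , mk⇔ reflect (mono y∈ y′∈)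
    where
    injective : f y ≡ f y′ → y ≡ y′
    injective fy≡fy′ with <-cmp y y′
    ... | tri< y<y′ _ _ = ⊥-elim (<-irrefl fy≡fy′ (mono y∈ y′∈ y<y′))
    ... | tri≈ _ y≡y′ _ = y≡y′
    ... | tri> _ _ y′<y = ⊥-elim (<-irrefl (sym fy≡fy′) (mono y′∈ y∈ y′<y))
    reflect : f y < f y′ → y < y′
    reflect fy<fy′ with <-cmp y y′
    ... | tri< y<y′ _ _ = y<y′
    ... | tri≈ _ refl _ = ⊥-elim (<-irrefl refl fy<fy′)
    ... | tri> _ _ y′<y = ⊥-elim (<-asym fy<fy′ (mono y′∈ y∈ y′<y))

Letter₂ Letter₃ : ℕ → Set
Letter₂ y = y ≡ 1 ⊎ y ≡ 2
Letter₃ y = y ≡ 1 ⊎ y ≡ 2 ⊎ y ≡ 3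

relabel₂ : ℕ → ℕ → ℕ → ℕ
relabel₂ a b 1 = a
relabel₂ a b _ = b

relabel₃ : ℕ → ℕ → ℕ → ℕ → ℕ
relabel₃ a b c 1 = a
relabel₃ a b c 2 = b
relabel₃ a b c _ = c

relabel₂-mono : ∀ {a b} → a < b → ∀ {y y′} → Letter₂ y → Letter₂ y′ → y < y′ → relabel₂ a b y < relabel₂ a b y′
relabel₂-mono a<b (inj₁ refl) (inj₂ refl) _ = a<b
relabel₂-mono a<b (inj₁ refl) (inj₁ refl) (s≤s ())
relabel₂-mono a<b (inj₂ refl) (inj₁ refl) (s≤s ())
relabel₂-mono a<b (inj₂ refl) (inj₂ refl) (s≤s (s≤s ()))

relabel₃-mono : ∀ {a b c} → a < b → b < c → ∀ {y y′} → Letter₃ y → Letter₃ y′ → y < y′ →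
  relabel₃ a b c y < relabel₃ a b c y′
relabel₃-mono a<b b<c (inj₁ refl) (inj₂ (inj₁ refl)) _ = a<b
relabel₃-mono a<b b<c (inj₁ refl) (inj₂ (inj₂ refl)) _ = <-trans a<b b<c
relabel₃-mono a<b b<c (inj₂ (inj₁ refl)) (inj₂ (inj₂ refl)) _ = b<c
relabel₃-mono a<b b<c (inj₁ refl) (inj₁ refl) (s≤s ())
relabel₃-mono a<b b<c (inj₂ (inj₁ refl)) (inj₁ refl) (s≤s ())
relabel₃-mono a<b b<c (inj₂ (inj₁ refl)) (inj₂ (inj₁ refl)) (s≤s (s≤s ()))
relabel₃-mono a<b b<c (inj₂ (inj₂ refl)) (inj₁ refl) (s≤s ())
relabel₃-mono a<b b<c (inj₂ (inj₂ refl)) (inj₂ (inj₁ refl)) (s≤s (s≤s ()))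
relabel₃-mono a<b b<c (inj₂ (inj₂ refl)) (inj₂ (inj₂ refl)) (s≤s (s≤s (s≤s ())))

contains₂ : ∀ {π a b} σ → All Letter₂ σ → a < b → map (relabel₂ a b) σ ⊆ π → Contains π σ
contains₂ σ letters a<b s⊆ =
  _ , s⊆ , orderIso-map _ σ (λ y∈ y′∈ → relabel₂-mono a<b (All.lookup letters y∈) (All.lookup letters y′∈))

contains₃ : ∀ {π a b c} σ → All Letter₃ σ → a < b → b < c → map (relabel₃ a b c) σ ⊆ π → Contains π σ
contains₃ σ letters a<b b<c s⊆ =
  _ , s⊆ , orderIso-map _ σ (λ y∈ y′∈ → relabel₃-mono a<b b<c (All.lookup letters y∈) (All.lookup letters y′∈))

has132⇒contains : ∀ {π} → Has132 π → Contains π (1 ∷ 3 ∷ 2 ∷ [])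
has132⇒contains (a , b , c , s⊆ , a<c , c<b) =
  contains₃ _ (inj₁ refl ∷ inj₂ (inj₂ refl) ∷ inj₂ (inj₁ refl) ∷ []) a<c c<b s⊆

has321⇒contains : ∀ {π} → Has321 π → Contains π (3 ∷ 2 ∷ 1 ∷ [])
has321⇒contains (a , b , c , s⊆ , c<b , b<a) =
  contains₃ _ (inj₂ (inj₂ refl) ∷ inj₂ (inj₁ refl) ∷ inj₁ refl ∷ []) c<b b<a s⊆

has1212⇒contains : ∀ {π} → Has1212 π → Contains π (1 ∷ 2 ∷ 1 ∷ 2 ∷ [])
has1212⇒contains (a , b , s⊆ , a<b) =
  contains₂ _ (inj₁ refl ∷ inj₂ refl ∷ inj₁ refl ∷ inj₂ refl ∷ []) a<b s⊆

has2121⇒contains : ∀ {π} → Has2121 π → Contains π (2 ∷ 1 ∷ 2 ∷ 1 ∷ [])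
has2121⇒contains (a , b , s⊆ , a<b) =
  contains₂ _ (inj₂ refl ∷ inj₁ refl ∷ inj₂ refl ∷ inj₁ refl ∷ []) a<b s⊆

open Equivalence using (from)

pattern #0 = here refl
pattern #1 = there (here refl)
pattern #2 = there (there (here refl))
pattern #3 = there (there (there (here refl)))

contains⇒has132 : ∀ {π} → Contains π (1 ∷ 3 ∷ 2 ∷ []) → Has132 π
contains⇒has132 (a ∷ b ∷ c ∷ [] , s⊆ , refl , iso) =
  a , b , c , s⊆ , from (proj₂ (iso #0 #2)) (s≤s (s≤s z≤n)) , from (proj₂ (iso #2 #1)) ≤-refl

contains⇒has321 : ∀ {π} → Contains π (3 ∷ 2 ∷ 1 ∷ []) → Has321 π
contains⇒has321 (a ∷ b ∷ c ∷ [] , s⊆ , refl , iso) =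
  a , b , c , s⊆ , from (proj₂ (iso #2 #1)) ≤-refl , from (proj₂ (iso #1 #0)) ≤-refl

contains⇒has1212 : ∀ {π} → Contains π (1 ∷ 2 ∷ 1 ∷ 2 ∷ []) → Has1212 π
contains⇒has1212 (a ∷ b ∷ a′ ∷ b′ ∷ [] , s⊆ , refl , iso)
  with refl ← from (proj₁ (iso #0 #2)) refl | refl ← from (proj₁ (iso #1 #3)) refl =
  a , b , s⊆ , from (proj₂ (iso #0 #1)) ≤-refl

contains⇒has2121 : ∀ {π} → Contains π (2 ∷ 1 ∷ 2 ∷ 1 ∷ []) → Has2121 π
contains⇒has2121 (b ∷ a ∷ b′ ∷ a′ ∷ [] , s⊆ , refl , iso)
  with refl ← from (proj₁ (iso #0 #2)) refl | refl ← from (proj₁ (iso #1 #3)) refl =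
  a , b , s⊆ , from (proj₂ (iso #1 #0)) ≤-refl

record AvoidsAll (π : List ℕ) : Set where
  constructor avoidsAll
  field
    no132 : ¬ Has132 π
    no321 : ¬ Has321 π
    no1212 : ¬ Has1212 π
    no2121 : ¬ Has2121 π

Q̄ : ℕ → List ℕ → Set
Q̄ n π = π ↭ doubledFrom 0 n × AvoidsAll π

QAvoid⇔Q̄ : ∀ n π → QAvoid n ((1 ∷ 3 ∷ 2 ∷ []) ∷ (3 ∷ 2 ∷ 1 ∷ []) ∷ []) π ⇔ Q̄ n π
QAvoid⇔Q̄ n π = mk⇔
  (λ { ((π↭ , ¬1212 , ¬2121) , ¬132 ∷ ¬321 ∷ []) →
       subst (π ↭_) (doubled≡doubledFrom n) π↭ ,
       avoidsAll (λ h → ¬132 (has132⇒contains h)) (λ h → ¬321 (has321⇒contains h))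
                 (λ h → ¬1212 (has1212⇒contains h)) (λ h → ¬2121 (has2121⇒contains h)) })
  (λ { (π↭ , avoidsAll ¬132 ¬321 ¬1212 ¬2121) →
       (subst (π ↭_) (sym (doubled≡doubledFrom n)) π↭ ,
        (λ c → ¬1212 (contains⇒has1212 c)) , (λ c → ¬2121 (contains⇒has2121 c))) ,
       (λ c → ¬132 (contains⇒has132 c)) ∷ (λ c → ¬321 (contains⇒has321 c)) ∷ [] })

avoidsAll-⊆ : ∀ {s w} → s ⊆ w → AvoidsAll w → AvoidsAll s
avoidsAll-⊆ s⊆w (avoidsAll ¬132 ¬321 ¬1212 ¬2121) = avoidsAll
  (λ { (a , b , c , p⊆ , lt) → ¬132 (a , b , c , ⊆-trans p⊆ s⊆w , lt) })
  (λ { (a , b , c , p⊆ , lt) → ¬321 (a , b , c , ⊆-trans p⊆ s⊆w , lt) })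
  (λ { (a , b , p⊆ , lt) → ¬1212 (a , b , ⊆-trans p⊆ s⊆w , lt) })
  (λ { (a , b , p⊆ , lt) → ¬2121 (a , b , ⊆-trans p⊆ s⊆w , lt) })

avoidsAll-[] : AvoidsAll []
avoidsAll-[] = avoidsAll (λ { (_ , _ , _ , () , _) }) (λ { (_ , _ , _ , () , _) })
                         (λ { (_ , _ , () , _) }) (λ { (_ , _ , () , _) })

module _ {U V : List ℕ} (ascU : Ascending U) (ascV : Ascending V) where

  ascending-++-no321 : ¬ Has321 (U ++ V)
  ascending-++-no321 (a , b , c , abc⊆ , c<b , b<a) with ⊆-++-split U V abc⊆
  ... | [] , _ , refl , _ , abc⊆V = <⇒≱ b<a (ascending-first (ascending-⊆ abc⊆V ascV))
  ... | _ ∷ [] , _ , refl , _ , bc⊆V = <⇒≱ c<b (ascending-first (ascending-⊆ bc⊆V ascV))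
  ... | _ ∷ _ ∷ [] , _ , refl , ab⊆U , _ = <⇒≱ b<a (ascending-first (ascending-⊆ ab⊆U ascU))
  ... | _ ∷ _ ∷ _ ∷ [] , _ , refl , abc⊆U , _ = <⇒≱ b<a (ascending-first (ascending-⊆ abc⊆U ascU))

  ascending-++-no2121 : ¬ Has2121 (U ++ V)
  ascending-++-no2121 (a , b , baba⊆ , a<b) with ⊆-++-split U V baba⊆
  ... | [] , _ , refl , _ , ⊆V = <⇒≱ a<b (ascending-first (ascending-⊆ ⊆V ascV))
  ... | _ ∷ [] , _ , refl , _ , ⊆V = <⇒≱ a<b (ascending-first (ascending-tail (ascending-⊆ ⊆V ascV)))
  ... | _ ∷ _ ∷ [] , _ , refl , ⊆U , _ = <⇒≱ a<b (ascending-first (ascending-⊆ ⊆U ascU))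
  ... | _ ∷ _ ∷ _ ∷ [] , _ , refl , ⊆U , _ = <⇒≱ a<b (ascending-first (ascending-⊆ ⊆U ascU))
  ... | _ ∷ _ ∷ _ ∷ _ ∷ [] , _ , refl , ⊆U , _ = <⇒≱ a<b (ascending-first (ascending-⊆ ⊆U ascU))

  ascending-++-no132 : (∀ {a b c} → a < c → c < b → a ∈ U → b ∈ U → c ∈ V → ⊥) → ¬ Has132 (U ++ V)
  ascending-++-no132 no-split (a , b , c , abc⊆ , a<c , c<b) with ⊆-++-split U V abc⊆
  ... | [] , _ , refl , _ , abc⊆V = <⇒≱ c<b (ascending-first (ascending-tail (ascending-⊆ abc⊆V ascV)))
  ... | _ ∷ [] , _ , refl , _ , bc⊆V = <⇒≱ c<b (ascending-first (ascending-⊆ bc⊆V ascV))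
  ... | _ ∷ _ ∷ [] , _ , refl , ab⊆U , c⊆V = no-split a<c c<b (to∈ ab⊆U) (to∈ (⊆.∷ˡ⁻ ab⊆U)) (to∈ c⊆V)
  ... | _ ∷ _ ∷ _ ∷ [] , _ , refl , abc⊆U , _ = <⇒≱ c<b (ascending-first (ascending-tail (ascending-⊆ abc⊆U ascU)))

  ascending-++-no1212 : (∀ {a b} → a < b → a ∈ U → b ∈ U → a ∈ V → b ∈ V → ⊥) → ¬ Has1212 (U ++ V)
  ascending-++-no1212 no-common (a , b , abab⊆ , a<b) with ⊆-++-split U V abab⊆
  ... | [] , _ , refl , _ , ⊆V = <⇒≱ a<b (ascending-first (ascending-tail (ascending-⊆ ⊆V ascV)))
  ... | _ ∷ [] , _ , refl , _ , ⊆V = <⇒≱ a<b (ascending-first (ascending-⊆ ⊆V ascV))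
  ... | _ ∷ _ ∷ [] , _ , refl , ab⊆U , ab⊆V =
    no-common a<b (to∈ ab⊆U) (to∈ (⊆.∷ˡ⁻ ab⊆U)) (to∈ ab⊆V) (to∈ (⊆.∷ˡ⁻ ab⊆V))
  ... | _ ∷ _ ∷ _ ∷ [] , _ , refl , ⊆U , _ = <⇒≱ a<b (ascending-first (ascending-tail (ascending-⊆ ⊆U ascU)))
  ... | _ ∷ _ ∷ _ ∷ _ ∷ [] , _ , refl , ⊆U , _ = <⇒≱ a<b (ascending-first (ascending-tail (ascending-⊆ ⊆U ascU)))

  avoidsAll-ascending-++ :
    (∀ {a b} → a < b → a ∈ U → b ∈ U → a ∈ V → b ∈ V → ⊥) →
    (∀ {a b c} → a < c → c < b → a ∈ U → b ∈ U → c ∈ V → ⊥) →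
    AvoidsAll (U ++ V)
  avoidsAll-ascending-++ no-common no-split =
    avoidsAll (ascending-++-no132 no-split) ascending-++-no321 (ascending-++-no1212 no-common) ascending-++-no2121

∈-[m,m] : ∀ {x m : ℕ} → x ∈ m ∷ m ∷ [] → x ≡ m
∈-[m,m] (here refl) = refl
∈-[m,m] (there (here refl)) = refl

⊆-[m,m] : ∀ {x y m : ℕ} {s} → x ∷ y ∷ s ⊆ m ∷ m ∷ [] → x ≡ y
⊆-[m,m] xy⊆ = trans (∈-[m,m] (to∈ xy⊆)) (sym (∈-[m,m] (to∈ (⊆.∷ˡ⁻ xy⊆))))

module _ {X : List ℕ} {m : ℕ} (below : ∀ {x} → x ∈ X → x < m) where

  ++-top-no132 : ¬ Has132 X → ¬ Has132 (X ++ m ∷ m ∷ [])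
  ++-top-no132 ¬132 (a , b , c , abc⊆ , a<c , c<b) with ⊆-++-split X _ abc⊆
  ... | [] , _ , refl , _ , ⊆m = <-irrefl (sym (⊆-[m,m] (⊆.∷ˡ⁻ ⊆m))) c<b
  ... | _ ∷ [] , _ , refl , _ , ⊆m = <-irrefl (sym (⊆-[m,m] ⊆m)) c<b
  ... | _ ∷ _ ∷ [] , _ , refl , ab⊆X , c⊆m with refl ← ∈-[m,m] (to∈ c⊆m) = <-asym c<b (below (to∈ (⊆.∷ˡ⁻ ab⊆X)))
  ... | _ ∷ _ ∷ _ ∷ [] , _ , refl , abc⊆X , _ = ¬132 (a , b , c , abc⊆X , a<c , c<b)

  ++-top-no321 : ¬ Has321 X → ¬ Has321 (X ++ m ∷ m ∷ [])
  ++-top-no321 ¬321 (a , b , c , abc⊆ , c<b , b<a) with ⊆-++-split X _ abc⊆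
  ... | [] , _ , refl , _ , ⊆m = <-irrefl (sym (⊆-[m,m] (⊆.∷ˡ⁻ ⊆m))) c<b
  ... | _ ∷ [] , _ , refl , _ , ⊆m = <-irrefl (sym (⊆-[m,m] ⊆m)) c<b
  ... | _ ∷ _ ∷ [] , _ , refl , ab⊆X , c⊆m with refl ← ∈-[m,m] (to∈ c⊆m) = <-asym c<b (below (to∈ (⊆.∷ˡ⁻ ab⊆X)))
  ... | _ ∷ _ ∷ _ ∷ [] , _ , refl , abc⊆X , _ = ¬321 (a , b , c , abc⊆X , c<b , b<a)

  ++-top-no1212 : ¬ Has1212 X → ¬ Has1212 (X ++ m ∷ m ∷ [])
  ++-top-no1212 ¬1212 (a , b , abab⊆ , a<b) with ⊆-++-split X _ abab⊆
  ... | [] , _ , refl , _ , ⊆m = <-irrefl (⊆-[m,m] ⊆m) a<b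
  ... | _ ∷ [] , _ , refl , _ , ⊆m = <-irrefl (sym (⊆-[m,m] ⊆m)) a<b
  ... | _ ∷ _ ∷ [] , _ , refl , _ , ⊆m = <-irrefl (⊆-[m,m] ⊆m) a<b
  ... | _ ∷ _ ∷ _ ∷ [] , _ , refl , aba⊆X , b⊆m with refl ← ∈-[m,m] (to∈ b⊆m) = <-irrefl refl (below (to∈ (⊆.∷ˡ⁻ aba⊆X)))
  ... | _ ∷ _ ∷ _ ∷ _ ∷ [] , _ , refl , abab⊆X , _ = ¬1212 (a , b , abab⊆X , a<b)

  ++-top-no2121 : ¬ Has2121 X → ¬ Has2121 (X ++ m ∷ m ∷ [])
  ++-top-no2121 ¬2121 (a , b , baba⊆ , a<b) with ⊆-++-split X _ baba⊆
  ... | [] , _ , refl , _ , ⊆m = <-irrefl (sym (⊆-[m,m] ⊆m)) a<b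
  ... | _ ∷ [] , _ , refl , _ , ⊆m = <-irrefl (⊆-[m,m] ⊆m) a<b
  ... | _ ∷ _ ∷ [] , _ , refl , _ , ⊆m = <-irrefl (sym (⊆-[m,m] ⊆m)) a<b
  ... | _ ∷ _ ∷ _ ∷ [] , _ , refl , bab⊆X , a⊆m with refl ← ∈-[m,m] (to∈ a⊆m) = <-asym a<b (below (to∈ bab⊆X))
  ... | _ ∷ _ ∷ _ ∷ _ ∷ [] , _ , refl , baba⊆X , _ = ¬2121 (a , b , baba⊆X , a<b)

  avoidsAll-++-top : AvoidsAll X → AvoidsAll (X ++ m ∷ m ∷ [])
  avoidsAll-++-top (avoidsAll ¬132 ¬321 ¬1212 ¬2121) =
    avoidsAll (++-top-no132 ¬132) (++-top-no321 ¬321) (++-top-no1212 ¬1212) (++-top-no2121 ¬2121)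

⊆-[x]-short : ∀ {a b x : ℕ} {s} → ¬ (a ∷ b ∷ s ⊆ [ x ])
⊆-[x]-short (_ ∷ʳ ())
⊆-[x]-short (_ ∷ ())

module _ {W : List ℕ} {x : ℕ} (above : ∀ {w} → w ∈ W → x ≤ w) where

  ++-min-no132 : ¬ Has132 W → ¬ Has132 (W ++ [ x ])
  ++-min-no132 ¬132 (a , b , c , abc⊆ , a<c , c<b) with ⊆-++-split W _ abc⊆
  ... | [] , _ , refl , _ , ⊆x = ⊆-[x]-short ⊆x
  ... | _ ∷ [] , _ , refl , _ , ⊆x = ⊆-[x]-short ⊆x
  ... | _ ∷ _ ∷ [] , _ , refl , ab⊆W , (refl ∷ _) = <⇒≱ a<c (above (to∈ ab⊆W))
  ... | _ ∷ _ ∷ [] , _ , refl , _ , (_ ∷ʳ ())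
  ... | _ ∷ _ ∷ _ ∷ [] , _ , refl , abc⊆W , _ = ¬132 (a , b , c , abc⊆W , a<c , c<b)

  ++-min-no1212 : ¬ Has1212 W → ¬ Has1212 (W ++ [ x ])
  ++-min-no1212 ¬1212 (a , b , abab⊆ , a<b) with ⊆-++-split W _ abab⊆
  ... | [] , _ , refl , _ , ⊆x = ⊆-[x]-short ⊆x
  ... | _ ∷ [] , _ , refl , _ , ⊆x = ⊆-[x]-short ⊆x
  ... | _ ∷ _ ∷ [] , _ , refl , _ , ⊆x = ⊆-[x]-short ⊆x
  ... | _ ∷ _ ∷ _ ∷ [] , _ , refl , aba⊆W , (refl ∷ _) = <⇒≱ a<b (above (to∈ aba⊆W))
  ... | _ ∷ _ ∷ _ ∷ [] , _ , refl , _ , (_ ∷ʳ ())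
  ... | _ ∷ _ ∷ _ ∷ _ ∷ [] , _ , refl , abab⊆W , _ = ¬1212 (a , b , abab⊆W , a<b)

++-min-no321 : ∀ {W x} → (∀ {p q} → p ∷ q ∷ [] ⊆ W → x < q → q < p → ⊥) → ¬ Has321 W → ¬ Has321 (W ++ [ x ])
++-min-no321 {W} no-descent ¬321 (a , b , c , abc⊆ , c<b , b<a) with ⊆-++-split W _ abc⊆
... | [] , _ , refl , _ , ⊆x = ⊆-[x]-short ⊆x
... | _ ∷ [] , _ , refl , _ , ⊆x = ⊆-[x]-short ⊆x
... | _ ∷ _ ∷ [] , _ , refl , ab⊆W , (refl ∷ _) = no-descent ab⊆W c<b b<a
... | _ ∷ _ ∷ [] , _ , refl , _ , (_ ∷ʳ ())
... | _ ∷ _ ∷ _ ∷ [] , _ , refl , abc⊆W , _ = ¬321 (a , b , c , abc⊆W , c<b , b<a)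

++-min-no2121 : ∀ {W x} → (∀ {b} → b ∷ x ∷ b ∷ [] ⊆ W → x < b → ⊥) → ¬ Has2121 W → ¬ Has2121 (W ++ [ x ])
++-min-no2121 {W} no-bxb ¬2121 (a , b , baba⊆ , a<b) with ⊆-++-split W _ baba⊆
... | [] , _ , refl , _ , ⊆x = ⊆-[x]-short ⊆x
... | _ ∷ [] , _ , refl , _ , ⊆x = ⊆-[x]-short ⊆x
... | _ ∷ _ ∷ [] , _ , refl , _ , ⊆x = ⊆-[x]-short ⊆x
... | _ ∷ _ ∷ _ ∷ [] , _ , refl , bab⊆W , (refl ∷ _) = no-bxb bab⊆W a<b
... | _ ∷ _ ∷ _ ∷ [] , _ , refl , _ , (_ ∷ʳ ())
... | _ ∷ _ ∷ _ ∷ _ ∷ [] , _ , refl , baba⊆W , _ = ¬2121 (a , b , baba⊆W , a<b)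

avoidsAll-++-min : ∀ {W x} → (∀ {w} → w ∈ W → x ≤ w) →
  (∀ {p q} → p ∷ q ∷ [] ⊆ W → x < q → q < p → ⊥) →
  (∀ {b} → b ∷ x ∷ b ∷ [] ⊆ W → x < b → ⊥) →
  AvoidsAll W → AvoidsAll (W ++ [ x ])
avoidsAll-++-min above no-descent no-bxb (avoidsAll ¬132 ¬321 ¬1212 ¬2121) =
  avoidsAll (++-min-no132 above ¬132) (++-min-no321 no-descent ¬321)
            (++-min-no1212 above ¬1212) (++-min-no2121 no-bxb ¬2121)

avoidsAll-ascending-++-lower : ∀ {U V} → Ascending U → Ascending V →
  (∀ {u v} → u ∈ U → v ∈ V → v ≤ u) → AvoidsAll (U ++ V)
avoidsAll-ascending-++-lower ascU ascV V≤U = avoidsAll-ascending-++ ascU ascV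
  (λ a<b a∈U _ _ b∈V → <⇒≱ a<b (V≤U a∈U b∈V))
  (λ a<c _ a∈U _ c∈V → <⇒≱ a<c (V≤U a∈U c∈V))

ascending-snoc : ∀ {xs y} → Ascending xs → (∀ {x} → x ∈ xs → x ≤ y) → Ascending (xs ++ [ y ])
ascending-snoc asc ≤y = ascending-++ asc ascending-[x] (λ { x∈ (here refl) → ≤y x∈ })

ascending-++-[m,m] : ∀ {xs m} → Ascending xs → (∀ {x} → x ∈ xs → x ≤ m) → Ascending (xs ++ m ∷ m ∷ [])
ascending-++-[m,m] asc ≤m = ascending-++ asc ascending-[x,x] (λ x∈ y∈ → subst (_ ≤_) (sym (∈-[m,m] y∈)) (≤m x∈))

-- The enumeration

low : ℕ → List ℕ
low j = doubledFrom 0 (suc j)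

high : ℕ → ℕ → List ℕ
high n j = doubledFrom (suc j) (n ∸ suc j)

appendTops : ℕ → List ℕ → List ℕ
appendTops n X = X ++ suc n ∷ suc n ∷ []

rotationTops : ℕ → ℕ → List ℕ
rotationTops n j = high n j ++ suc n ∷ suc n ∷ low j

rotationSplitTops : ℕ → ℕ → List ℕ
rotationSplitTops n j = high n j ++ suc n ∷ low j ++ suc n ∷ []

oneAfterTops : ℕ → ℕ → List ℕ
oneAfterTops n i = (doubledFrom 1 i ++ 1 ∷ high n i) ++ suc n ∷ suc n ∷ 1 ∷ []

brokenPairTops : ℕ → ℕ → List ℕ
brokenPairTops n j = (t ∷ doubledFrom t (n ∸ t)) ++ suc n ∷ suc n ∷ low j ++ [ t ]
  where
  t : ℕ
  t = suc (suc j)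

brokenPairs : ℕ → List (List ℕ)
brokenPairs zero = []
brokenPairs (suc n) = map (brokenPairTops (suc n)) (upTo n)

enumQ̄ : ℕ → List (List ℕ)
enumQ̄ zero = [] ∷ []
enumQ̄ (suc n) =
  map (appendTops n) (enumQ̄ n) ++ map (rotationTops n) (upTo n) ++
  map (rotationSplitTops n) (upTo n) ++ map (oneAfterTops n) (upTo n) ++ brokenPairs n

doubledFrom-split : ∀ {k n} → k ≤ n → doubledFrom 0 k ++ doubledFrom k (n ∸ k) ≡ doubledFrom 0 n
doubledFrom-split {k} {n} k≤n = trans (sym (doubledFrom-++ 0 k (n ∸ k))) (cong (doubledFrom 0) (m+[n∸m]≡n k≤n))

low-bound : ∀ {j x} → x ∈ low j → x ≤ suc j
low-bound {j} x∈ = proj₂ (doubledFrom-bounds 0 (suc j) x∈)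

high-bounds : ∀ {n j x} → j < n → x ∈ high n j → suc j < x × x ≤ n
high-bounds {n} {j} j<n x∈ with doubledFrom-bounds (suc j) (n ∸ suc j) x∈
... | j+1<x , x≤ = j+1<x , subst (_ ≤_) (m+[n∸m]≡n j<n) x≤

tops-↭ : ∀ {n w} → w ↭ doubledFrom 0 n → suc n ∷ suc n ∷ w ↭ doubledFrom 0 (suc n)
tops-↭ {n} {w} w↭ = begin
  suc n ∷ suc n ∷ w                 ↭⟨ ++⁺ˡ (suc n ∷ suc n ∷ []) w↭ ⟩
  suc n ∷ suc n ∷ doubledFrom 0 n   ↭⟨ ++-comm (suc n ∷ suc n ∷ []) (doubledFrom 0 n) ⟩
  doubledFrom 0 n ++ suc n ∷ suc n ∷ [] ≡⟨ sym (doubledFrom-snoc 0 n) ⟩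
  doubledFrom 0 (suc n)             ∎
  where open PermutationReasoning

appendTops-Q̄ : ∀ {n X} → Q̄ n X → Q̄ (suc n) (appendTops n X)
appendTops-Q̄ {n} {X} (X↭ , avX) =
  ↭-trans (++-comm X _) (tops-↭ X↭) ,
  avoidsAll-++-top (λ x∈ → s≤s (proj₂ (doubledFrom-bounds 0 n (∈-resp-↭ X↭ x∈)))) avX

high++tops-bounds : ∀ {n j x} → j < n → x ∈ high n j ++ suc n ∷ suc n ∷ [] → suc j < x × x ≤ suc n
high++tops-bounds {n} {j} j<n x∈ with ∈-++⁻ (high n j) x∈
... | inj₁ x∈high = proj₁ (high-bounds j<n x∈high) , ≤-trans (proj₂ (high-bounds j<n x∈high)) (n≤1+n n)
... | inj₂ x∈tops rewrite ∈-[m,m] x∈tops = s≤s j<n , ≤-refl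

high++tops-ascending : ∀ {n j} → j < n → Ascending (high n j ++ suc n ∷ suc n ∷ [])
high++tops-ascending j<n =
  ascending-++-[m,m] (ascending-doubledFrom _ _) (λ x∈ → proj₂ (high++tops-bounds j<n (∈-++⁺ˡ x∈)))

rotationTops-↭ : ∀ {n j} → j < n → rotationTops n j ↭ doubledFrom 0 (suc n)
rotationTops-↭ {n} {j} j<n = begin
  high n j ++ suc n ∷ suc n ∷ low j ↭⟨ ++-comm (high n j) _ ⟩
  suc n ∷ suc n ∷ low j ++ high n j ↭⟨ tops-↭ (↭-reflexive (doubledFrom-split j<n)) ⟩
  doubledFrom 0 (suc n)             ∎
  where open PermutationReasoning

rotationTops-avoidsAll : ∀ {n j} → j < n → AvoidsAll (rotationTops n j)
rotationTops-avoidsAll {n} {j} j<n = subst AvoidsAll (++-assoc (high n j) _ (low j))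
  (avoidsAll-ascending-++-lower (high++tops-ascending j<n) (ascending-doubledFrom 0 (suc j))
    (λ u∈ v∈ → <⇒≤ (≤-<-trans (low-bound v∈) (proj₁ (high++tops-bounds j<n u∈)))))

rotationSplitTops-↭ : ∀ {n j} → j < n → rotationSplitTops n j ↭ doubledFrom 0 (suc n)
rotationSplitTops-↭ {n} {j} j<n = begin
  high n j ++ m ∷ low j ++ [ m ]   ↭⟨ ++-comm (high n j) _ ⟩
  m ∷ (low j ++ [ m ]) ++ high n j ≡⟨ cong (m ∷_) (++-assoc (low j) [ m ] (high n j)) ⟩
  m ∷ low j ++ m ∷ high n j        ↭⟨ ++⁺ˡ [ m ] (shift m (low j) (high n j)) ⟩
  m ∷ m ∷ low j ++ high n j        ↭⟨ tops-↭ (↭-reflexive (doubledFrom-split j<n)) ⟩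
  doubledFrom 0 m                  ∎
  where
  open PermutationReasoning
  m : ℕ
  m = suc n

rotationSplitTops-avoidsAll : ∀ {n j} → j < n → AvoidsAll (rotationSplitTops n j)
rotationSplitTops-avoidsAll {n} {j} j<n = subst AvoidsAll (++-assoc (high n j) _ _)
  (avoidsAll-ascending-++ ascU ascV no-common no-split)
  where
  m : ℕ
  m = suc n
  U V : List ℕ
  U = high n j ++ [ m ]
  V = low j ++ [ m ]
  U-bounds : ∀ {u} → u ∈ U → suc j < u × u ≤ m
  U-bounds u∈ with ∈-++⁻ (high n j) u∈
  ... | inj₁ u∈high = proj₁ (high-bounds j<n u∈high) , ≤-trans (proj₂ (high-bounds j<n u∈high)) (n≤1+n n)
  ... | inj₂ (here refl) = s≤s j<n , ≤-refl
  V-bounds : ∀ {v} → v ∈ V → v ≤ suc j ⊎ v ≡ m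
  V-bounds v∈ with ∈-++⁻ (low j) v∈
  ... | inj₁ v∈low = inj₁ (low-bound v∈low)
  ... | inj₂ (here refl) = inj₂ refl
  ascU : Ascending U
  ascU = ascending-snoc (ascending-doubledFrom _ _) (λ u∈ → proj₂ (U-bounds (∈-++⁺ˡ u∈)))
  ascV : Ascending V
  ascV = ascending-snoc (ascending-doubledFrom _ _) (λ v∈ → ≤-trans (low-bound v∈) (<⇒≤ (s≤s j<n)))
  no-common : ∀ {a b} → a < b → a ∈ U → b ∈ U → a ∈ V → b ∈ V → ⊥
  no-common a<b a∈U b∈U a∈V _ with V-bounds a∈V
  ... | inj₁ a≤j+1 = <⇒≱ (proj₁ (U-bounds a∈U)) a≤j+1
  ... | inj₂ refl = <⇒≱ a<b (proj₂ (U-bounds b∈U))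
  no-split : ∀ {a b c} → a < c → c < b → a ∈ U → b ∈ U → c ∈ V → ⊥
  no-split a<c c<b a∈U b∈U c∈V with V-bounds c∈V
  ... | inj₁ c≤j+1 = <⇒≱ (<-trans (proj₁ (U-bounds a∈U)) a<c) c≤j+1
  ... | inj₂ refl = <⇒≱ c<b (proj₂ (U-bounds b∈U))

module _ {n j : ℕ} (t≤n : suc (suc j) ≤ n) where
  private
    t : ℕ
    t = suc (suc j)
    H : List ℕ
    H = doubledFrom t (n ∸ t)

    low+t+t+H : (low j ++ [ t ]) ++ t ∷ H ≡ doubledFrom 0 n
    low+t+t+H = begin
      (low j ++ [ t ]) ++ t ∷ H  ≡⟨ ++-assoc (low j) [ t ] (t ∷ H) ⟩
      low j ++ t ∷ t ∷ H         ≡⟨ sym (++-assoc (low j) (t ∷ t ∷ []) H) ⟩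
      (low j ++ t ∷ t ∷ []) ++ H ≡⟨ cong (_++ H) (sym (doubledFrom-snoc 0 (suc j))) ⟩
      doubledFrom 0 t ++ H       ≡⟨ doubledFrom-split t≤n ⟩
      doubledFrom 0 n            ∎
      where open ≡-Reasoning

  brokenPairTops-↭ : brokenPairTops n j ↭ doubledFrom 0 (suc n)
  brokenPairTops-↭ = begin
    (t ∷ H) ++ suc n ∷ suc n ∷ low j ++ [ t ] ↭⟨ ++-comm (t ∷ H) _ ⟩
    suc n ∷ suc n ∷ (low j ++ [ t ]) ++ t ∷ H ↭⟨ tops-↭ (↭-reflexive low+t+t+H) ⟩
    doubledFrom 0 (suc n)                     ∎
    where open PermutationReasoning

  brokenPairTops-avoidsAll : AvoidsAll (brokenPairTops n j)
  brokenPairTops-avoidsAll = subst AvoidsAll (++-assoc (t ∷ H) _ _)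
    (avoidsAll-ascending-++-lower ascU ascV (λ u∈ v∈ → ≤-trans (V≤t v∈) (t≤U u∈)))
    where
    U V : List ℕ
    U = (t ∷ H) ++ suc n ∷ suc n ∷ []
    V = low j ++ [ t ]
    H-bounds : ∀ {x} → x ∈ H → t < x × x ≤ n
    H-bounds x∈ with doubledFrom-bounds t (n ∸ t) x∈
    ... | t<x , x≤ = t<x , subst (_ ≤_) (m+[n∸m]≡n t≤n) x≤
    ascU : Ascending U
    ascU = ascending-++-[m,m] (ascending-∷ (λ x∈ → <⇒≤ (proj₁ (H-bounds x∈))) (ascending-doubledFrom t (n ∸ t)))
      λ { (here refl) → ≤-trans t≤n (n≤1+n n) ; (there x∈) → ≤-trans (proj₂ (H-bounds x∈)) (n≤1+n n) }
    ascV : Ascending V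
    ascV = ascending-snoc (ascending-doubledFrom 0 (suc j)) λ v∈ → ≤-trans (low-bound v∈) (n≤1+n _)
    t≤U : ∀ {u} → u ∈ U → t ≤ u
    t≤U u∈ with ∈-++⁻ (t ∷ H) u∈
    ... | inj₁ (here refl) = ≤-refl
    ... | inj₁ (there u∈H) = <⇒≤ (proj₁ (H-bounds u∈H))
    ... | inj₂ u∈tops rewrite ∈-[m,m] u∈tops = ≤-trans t≤n (n≤1+n n)
    V≤t : ∀ {v} → v ∈ V → v ≤ t
    V≤t v∈ with ∈-++⁻ (low j) v∈
    ... | inj₁ v∈low = ≤-trans (low-bound v∈low) (n≤1+n _)
    ... | inj₂ (here refl) = ≤-refl

-- oneAfterTops n i = D V 1 where D V is a concatenation of ascending words on disjoint letters,
-- every letter of V but its head 1 lying above D; so D V has no descent above 1 and no b 1 b.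
module _ {n i : ℕ} (i<n : i < n) where
  private
    D V : List ℕ
    D = doubledFrom 1 i
    V = 1 ∷ high n i ++ suc n ∷ suc n ∷ []

    D-bounds : ∀ {x} → x ∈ D → 1 < x × x ≤ suc i
    D-bounds = doubledFrom-bounds 1 i

    V-cases : ∀ {v} → v ∈ V → v ≡ 1 ⊎ suc i < v
    V-cases (here refl) = inj₁ refl
    V-cases (there v∈) = inj₂ (proj₁ (high++tops-bounds i<n v∈))

    ascD : Ascending D
    ascD = ascending-doubledFrom 1 i

    ascV : Ascending V
    ascV = ascending-∷ (λ x∈ → ≤-trans (s≤s z≤n) (<⇒≤ (proj₁ (high++tops-bounds i<n x∈)))) (high++tops-ascending i<n)

    D++V-positive : ∀ {w} → w ∈ D ++ V → 1 ≤ w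
    D++V-positive w∈ with ∈-++⁻ D w∈
    ... | inj₁ w∈D = <⇒≤ (proj₁ (D-bounds w∈D))
    ... | inj₂ w∈V with V-cases w∈V
    ...   | inj₁ refl = ≤-refl
    ...   | inj₂ i+1<w = ≤-trans (s≤s z≤n) (<⇒≤ i+1<w)

    D++V-avoidsAll : AvoidsAll (D ++ V)
    D++V-avoidsAll = avoidsAll-ascending-++ ascD ascV
      (λ _ a∈D _ a∈V _ → disjoint a∈D a∈V)
      (λ a<c c<b a∈D b∈D c∈V → no-split a<c c<b a∈D b∈D c∈V)
      where
      disjoint : ∀ {a} → a ∈ D → a ∈ V → ⊥
      disjoint a∈D a∈V with V-cases a∈V
      ... | inj₁ refl = <-irrefl refl (proj₁ (D-bounds a∈D))
      ... | inj₂ i+1<a = <⇒≱ i+1<a (proj₂ (D-bounds a∈D))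
      no-split : ∀ {a b c} → a < c → c < b → a ∈ D → b ∈ D → c ∈ V → ⊥
      no-split a<c c<b a∈D b∈D c∈V with V-cases c∈V
      ... | inj₁ refl = <-asym a<c (proj₁ (D-bounds a∈D))
      ... | inj₂ i+1<c = <⇒≱ (<-trans i+1<c c<b) (proj₂ (D-bounds b∈D))

    no-descent-above-1 : ∀ {p q} → p ∷ q ∷ [] ⊆ D ++ V → 1 < q → q < p → ⊥
    no-descent-above-1 pq⊆ 1<q q<p with ⊆-++-split D V pq⊆
    ... | [] , _ , refl , _ , pq⊆V = <⇒≱ q<p (ascending-first (ascending-⊆ pq⊆V ascV))
    ... | _ ∷ [] , _ , refl , p⊆D , q⊆V with V-cases (to∈ q⊆V)
    ...   | inj₁ refl = <-irrefl refl 1<q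
    ...   | inj₂ i+1<q = <⇒≱ (<-trans i+1<q q<p) (proj₂ (D-bounds (to∈ p⊆D)))
    no-descent-above-1 pq⊆ 1<q q<p | _ ∷ _ ∷ [] , _ , refl , pq⊆D , _ =
      <⇒≱ q<p (ascending-first (ascending-⊆ pq⊆D ascD))

    no-b1b : ∀ {b} → b ∷ 1 ∷ b ∷ [] ⊆ D ++ V → 1 < b → ⊥
    no-b1b b1b⊆ 1<b with ⊆-++-split D V b1b⊆
    ... | [] , _ , refl , _ , b1b⊆V = <⇒≱ 1<b (ascending-first (ascending-⊆ b1b⊆V ascV))
    ... | _ ∷ [] , _ , refl , b⊆D , 1b⊆V with V-cases (to∈ (⊆.∷ˡ⁻ 1b⊆V))
    ...   | inj₁ refl = <-irrefl refl 1<b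
    ...   | inj₂ i+1<b = <⇒≱ i+1<b (proj₂ (D-bounds (to∈ b⊆D)))
    no-b1b b1b⊆ 1<b | _ ∷ _ ∷ [] , _ , refl , b1⊆D , _ = <-irrefl refl (proj₁ (D-bounds (to∈ (⊆.∷ˡ⁻ b1⊆D))))
    no-b1b b1b⊆ 1<b | _ ∷ _ ∷ _ ∷ [] , _ , refl , b1b⊆D , _ = <-irrefl refl (proj₁ (D-bounds (to∈ (⊆.∷ˡ⁻ b1b⊆D))))

  oneAfterTops-↭ : oneAfterTops n i ↭ doubledFrom 0 (suc n)
  oneAfterTops-↭ = begin
    (D ++ 1 ∷ high n i) ++ suc n ∷ suc n ∷ [ 1 ] ↭⟨ ++-comm (D ++ 1 ∷ high n i) _ ⟩
    suc n ∷ suc n ∷ 1 ∷ D ++ 1 ∷ high n i         ↭⟨ ++⁺ˡ (suc n ∷ suc n ∷ [ 1 ]) (shift 1 D (high n i)) ⟩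
    suc n ∷ suc n ∷ low i ++ high n i             ↭⟨ tops-↭ (↭-reflexive (doubledFrom-split i<n)) ⟩
    doubledFrom 0 (suc n)                         ∎
    where open PermutationReasoning

  oneAfterTops-avoidsAll : AvoidsAll (oneAfterTops n i)
  oneAfterTops-avoidsAll = subst AvoidsAll reassociate
    (avoidsAll-++-min D++V-positive no-descent-above-1 no-b1b D++V-avoidsAll)
    where
    reassociate : (D ++ V) ++ [ 1 ] ≡ oneAfterTops n i
    reassociate = begin
      (D ++ 1 ∷ high n i ++ suc n ∷ suc n ∷ []) ++ [ 1 ] ≡⟨ ++-assoc D _ [ 1 ] ⟩
      D ++ 1 ∷ (high n i ++ suc n ∷ suc n ∷ []) ++ [ 1 ] ≡⟨ cong (λ w → D ++ 1 ∷ w) (++-assoc (high n i) _ [ 1 ]) ⟩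
      D ++ 1 ∷ high n i ++ suc n ∷ suc n ∷ [ 1 ]        ≡⟨ sym (++-assoc D (1 ∷ high n i) _) ⟩
      oneAfterTops n i                                  ∎
      where open ≡-Reasoning

-- Completeness

∈-∃++-first : ∀ {x : ℕ} {w} → x ∈ w → ∃₂ λ w₁ w₂ → w ≡ w₁ ++ x ∷ w₂ × x ∉ w₁
∈-∃++-first {x} {y ∷ w} x∈ with x ≟ y
... | yes refl = [] , w , refl , λ ()
... | no x≢y with x∈
...   | here x≡y = ⊥-elim (x≢y x≡y)
...   | there x∈w with ∈-∃++-first x∈w
...     | w₁ , w₂ , refl , x∉w₁ = y ∷ w₁ , w₂ , refl , λ { (here x≡y) → x≢y x≡y ; (there x∈w₁) → x∉w₁ x∈w₁ }

↭-drop-second : ∀ {x : ℕ} {X R w} → x ∉ X → X ++ x ∷ R ↭ x ∷ x ∷ w →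
  ∃₂ λ Y Z → R ≡ Y ++ x ∷ Z × X ++ Y ++ Z ↭ w
↭-drop-second {x} {X} {w = w} x∉X p with ∈-++⁻ X (∈-resp-↭ (↭-sym (drop-mid X [] p)) (here refl))
... | inj₁ x∈X = ⊥-elim (x∉X x∈X)
... | inj₂ x∈R with ∈-∃++ x∈R
...   | Y , Z , refl = Y , Z , refl ,
  subst (_↭ w) (++-assoc X Y Z) (drop-mid (X ++ Y) [] (subst (_↭ x ∷ w) (sym (++-assoc X Y (x ∷ Z))) (drop-mid X [] p)))

top-decomposition : ∀ {n π} → π ↭ doubledFrom 0 (suc n) →
  ∃ λ X → ∃ λ Y → ∃ λ Z → π ≡ X ++ suc n ∷ Y ++ suc n ∷ Z × X ++ Y ++ Z ↭ doubledFrom 0 n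
top-decomposition {n} π↭ with ∈-∃++-first (∈-resp-↭ (↭-sym π↭) (doubledFrom-top n))
... | X , R , refl , m∉X with ↭-drop-second m∉X (↭-trans π↭ (↭-sym (tops-↭ ↭-refl)))
...   | Y , Z , refl , XYZ↭ = X , Y , Z , refl , XYZ↭

data DoubledSplit (a c : ℕ) (P Q : List ℕ) : Set where
  between-pairs : ∀ k {c′} → k + c′ ≡ c → P ≡ doubledFrom a k → Q ≡ doubledFrom (a + k) c′ →
    DoubledSplit a c P Q
  inside-pair : ∀ k {c′} → suc k + c′ ≡ c → P ≡ doubledFrom a k ++ [ suc (a + k) ] →
    Q ≡ suc (a + k) ∷ doubledFrom (suc (a + k)) c′ → DoubledSplit a c P Q

doubledSplit : ∀ a c P Q → P ++ Q ≡ doubledFrom a c → DoubledSplit a c P Q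
doubledSplit a c [] Q Q≡ = between-pairs 0 refl refl (trans Q≡ (cong (λ b → doubledFrom b c) (sym (+-identityʳ a))))
doubledSplit a (suc c) (_ ∷ []) Q refl =
  inside-pair 0 refl (cong (λ b → [ suc b ]) (sym (+-identityʳ a)))
    (cong (λ b → suc b ∷ doubledFrom (suc b) c) (sym (+-identityʳ a)))
doubledSplit a (suc c) (_ ∷ _ ∷ P) Q PQ≡
  with refl ← ∷-injectiveˡ PQ≡ | refl ← ∷-injectiveˡ (∷-injectiveʳ PQ≡)
  with doubledSplit (suc a) c P Q (∷-injectiveʳ (∷-injectiveʳ PQ≡))
... | between-pairs k {c′} refl refl Q≡ =
  between-pairs (suc k) refl refl (trans Q≡ (cong (λ b → doubledFrom b c′) (sym (+-suc a k))))
... | inside-pair k {c′} refl refl Q≡ =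
  inside-pair (suc k) refl (cong (λ b → suc a ∷ suc a ∷ doubledFrom (suc a) k ++ [ suc b ]) (sym (+-suc a k)))
    (trans Q≡ (cong (λ b → suc b ∷ doubledFrom (suc b) c′) (sym (+-suc a k))))

∈-map-upTo : ∀ (f : ℕ → List ℕ) {j n} → j < n → f j ∈ map f (upTo n)
∈-map-upTo f j<n = ∈-map⁺ f (∈-upTo⁺ j<n)

brokenPairTops∈brokenPairs : ∀ {n j} → suc j < n → brokenPairTops n j ∈ brokenPairs n
brokenPairTops∈brokenPairs {suc n} (s≤s j<n) = ∈-map-upTo (brokenPairTops (suc n)) j<n

module _ {n : ℕ} where
  private
    A B C E : List (List ℕ)
    A = map (appendTops n) (enumQ̄ n)
    B = map (rotationTops n) (upTo n)
    C = map (rotationSplitTops n) (upTo n)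
    E = map (oneAfterTops n) (upTo n)

  appendTops∈enumQ̄ : ∀ {X} → X ∈ enumQ̄ n → appendTops n X ∈ enumQ̄ (suc n)
  appendTops∈enumQ̄ X∈ = ∈-++⁺ˡ (∈-map⁺ (appendTops n) X∈)

  rotationTops∈enumQ̄ : ∀ {j} → j < n → rotationTops n j ∈ enumQ̄ (suc n)
  rotationTops∈enumQ̄ j<n = ∈-++⁺ʳ A (∈-++⁺ˡ (∈-map-upTo (rotationTops n) j<n))

  rotationSplitTops∈enumQ̄ : ∀ {j} → j < n → rotationSplitTops n j ∈ enumQ̄ (suc n)
  rotationSplitTops∈enumQ̄ j<n = ∈-++⁺ʳ A (∈-++⁺ʳ B (∈-++⁺ˡ (∈-map-upTo (rotationSplitTops n) j<n)))

  oneAfterTops∈enumQ̄ : ∀ {i} → i < n → oneAfterTops n i ∈ enumQ̄ (suc n)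
  oneAfterTops∈enumQ̄ i<n = ∈-++⁺ʳ A (∈-++⁺ʳ B (∈-++⁺ʳ C (∈-++⁺ˡ (∈-map-upTo (oneAfterTops n) i<n))))

  brokenPairTops∈enumQ̄ : ∀ {j} → suc j < n → brokenPairTops n j ∈ enumQ̄ (suc n)
  brokenPairTops∈enumQ̄ j+1<n = ∈-++⁺ʳ A (∈-++⁺ʳ B (∈-++⁺ʳ C (∈-++⁺ʳ E (brokenPairTops∈brokenPairs j+1<n))))

module TopDecomposition {n : ℕ} {X Y Z : List ℕ} (XYZ↭ : X ++ Y ++ Z ↭ doubledFrom 0 n)
  (av : AvoidsAll (X ++ suc n ∷ Y ++ suc n ∷ Z)) where

  open AvoidsAll av

  m : ℕ
  m = suc n

  letter-bounds : ∀ {w} → w ∈ X ++ Y ++ Z → 0 < w × w ≤ n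
  letter-bounds w∈ = doubledFrom-bounds 0 n (∈-resp-↭ XYZ↭ w∈)

  X-bounds : ∀ {w} → w ∈ X → 0 < w × w ≤ n
  X-bounds w∈ = letter-bounds (∈-++⁺ˡ w∈)

  Y-bounds : ∀ {w} → w ∈ Y → 0 < w × w ≤ n
  Y-bounds w∈ = letter-bounds (∈-++⁺ʳ X (∈-++⁺ˡ w∈))

  Z-bounds : ∀ {w} → w ∈ Z → 0 < w × w ≤ n
  Z-bounds w∈ = letter-bounds (∈-++⁺ʳ X (∈-++⁺ʳ Y w∈))

  Y++Z-ascending : Ascending (Y ++ Z)
  Y++Z-ascending {a} {b} ab⊆ = ≮⇒≥ λ b<a → no321
    (m , a , b , ⊆.++⁺ˡ X (refl ∷ ⊆-trans ab⊆ (⊆.++⁺ ⊆-refl (m ∷ʳ ⊆-refl))) , b<a ,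
     s≤s (proj₂ (letter-bounds (∈-++⁺ʳ X (to∈ ab⊆)))))

  Y∩X-empty : ∀ {v} → v ∈ Y → v ∈ X → ⊥
  Y∩X-empty v∈Y v∈X = no1212
    (_ , m , ∈-++-⊆ v∈X (refl ∷ ∈-++-⊆ v∈Y (refl ∷ minimum Z)) , s≤s (proj₂ (X-bounds v∈X)))

  Y∩Z-empty : ∀ {v} → v ∈ Y → v ∈ Z → ⊥
  Y∩Z-empty v∈Y v∈Z = no2121
    (_ , m , ⊆.++⁺ˡ X (refl ∷ ∈-++-⊆ v∈Y (refl ∷ from∈ v∈Z)) , s≤s (proj₂ (Y-bounds v∈Y)))

  Y<X : ∀ {x y} → x ∈ X → y ∈ Y → y < x
  Y<X {x} {y} x∈ y∈ = ≤∧≢⇒< (≮⇒≥ λ x<y → no132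
    (x , m , y , ∈-++-⊆ x∈ (refl ∷ ∈-++-⊆ y∈ (minimum _)) , x<y , s≤s (proj₂ (Y-bounds y∈))))
    λ { refl → Y∩X-empty y∈ x∈ }

  Z≤X : ∀ {x z} → x ∈ X → z ∈ Z → z ≤ x
  Z≤X {x} {z} x∈ z∈ = ≮⇒≥ λ x<z → no132
    (x , m , z , ∈-++-⊆ x∈ (refl ∷ ⊆.++⁺ˡ Y (m ∷ʳ from∈ z∈)) , x<z , s≤s (proj₂ (Z-bounds z∈)))

  ¬Y<Z : ∀ {y z} → y ∈ Y → z ∈ Z → y < z → ⊥
  ¬Y<Z {y} {z} y∈ z∈ y<z = no132
    (y , m , z , ⊆.++⁺ˡ X (m ∷ʳ ∈-++-⊆ y∈ (refl ∷ from∈ z∈)) , y<z , s≤s (proj₂ (Z-bounds z∈)))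

  X-descent-above-Y : ∀ {a b y} → a ∷ b ∷ [] ⊆ X → b < a → y ∈ Y → y < b → ⊥
  X-descent-above-Y ab⊆ b<a y∈ y<b = no321
    (_ , _ , _ , ⊆.++⁺ ab⊆ (m ∷ʳ ∈-++-⊆ y∈ (minimum _)) , y<b , b<a)

  Z-ones : 1 ∈ X → ∀ {z} → z ∈ Z → z ≡ 1
  Z-ones 1∈X z∈ = ≤-antisym (Z≤X 1∈X z∈) (proj₁ (Z-bounds z∈))

  X-descent-above-Z : ∀ {a b z} → a ∷ b ∷ [] ⊆ X → b < a → z ∈ Z → z < b → ⊥
  X-descent-above-Z ab⊆ b<a z∈ z<b = no321
    (_ , _ , _ , ⊆.++⁺ ab⊆ (m ∷ʳ ⊆.++⁺ˡ Y (m ∷ʳ from∈ z∈)) , z<b , b<a)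

doubledFrom-+∸ : ∀ a c → doubledFrom a (a + c ∸ a) ≡ doubledFrom a c
doubledFrom-+∸ a c = cong (doubledFrom a) (m+n∸m≡n a c)

Y-Z-nonempty-impossible : ∀ {n X y Y z Z} → X ++ (y ∷ Y) ++ (z ∷ Z) ↭ doubledFrom 0 n →
  ¬ AvoidsAll (X ++ suc n ∷ (y ∷ Y) ++ suc n ∷ z ∷ Z)
Y-Z-nonempty-impossible {X = X} {y} {Y} {z} {Z} XYZ↭ av = Y∩Z-empty (here refl) (here y≡z)
  where
  open TopDecomposition {X = X} {y ∷ Y} {z ∷ Z} XYZ↭ av
  y≡z : y ≡ z
  y≡z = ≤-antisym (Y++Z-ascending (refl ∷ ⊆.++⁺ˡ Y (refl ∷ minimum Z))) (≮⇒≥ (¬Y<Z (here refl) (here refl)))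

Y-nonempty-case : ∀ {n X y Y} → X ++ (y ∷ Y) ++ [] ↭ doubledFrom 0 n →
  AvoidsAll (X ++ suc n ∷ (y ∷ Y) ++ suc n ∷ []) → X ++ suc n ∷ (y ∷ Y) ++ suc n ∷ [] ∈ enumQ̄ (suc n)
Y-nonempty-case {n} {X} {y} {Y} XYZ↭ av with doubledSplit 0 n (y ∷ Y) X Y++X≡
  where
  open TopDecomposition {X = X} {y ∷ Y} {[]} XYZ↭ av
  ascY : Ascending (y ∷ Y)
  ascY = ascending-⊆ (⊆.++⁺ʳ [] ⊆-refl) Y++Z-ascending
  ascX : Ascending X
  ascX ab⊆ = ≮⇒≥ λ b<a → X-descent-above-Y ab⊆ b<a (here refl) (Y<X (to∈ (⊆.∷ˡ⁻ ab⊆)) (here refl))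
  Y++X≡ : (y ∷ Y) ++ X ≡ doubledFrom 0 n
  Y++X≡ = ascending-↭⇒≡ (ascending-++ ascY ascX (λ y∈ x∈ → <⇒≤ (Y<X x∈ y∈))) (ascending-doubledFrom 0 n)
    (↭-trans (++-comm (y ∷ Y) X) (subst (λ w → X ++ w ↭ doubledFrom 0 n) (++-identityʳ (y ∷ Y)) XYZ↭))
... | between-pairs (suc j) {c} refl refl refl rewrite sym (doubledFrom-+∸ (suc j) c) = rotationSplitTops∈enumQ̄ (m≤m+n (suc j) c)
... | inside-pair k refl Y≡ X≡ = ⊥-elim (TopDecomposition.Y∩X-empty {X = X} {y ∷ Y} {[]} XYZ↭ av
  (subst (suc k ∈_) (sym Y≡) (∈-++⁺ʳ (doubledFrom 0 k) (here refl))) (subst (suc k ∈_) (sym X≡) (here refl)))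

one∈doubledFrom : ∀ {n} → 0 < n → 1 ∈ doubledFrom 0 n
one∈doubledFrom {suc n} _ = here refl

Z-nonempty-1∉X-case : ∀ {n X z Z} → 1 ∉ X → X ++ [] ++ z ∷ Z ↭ doubledFrom 0 n →
  AvoidsAll (X ++ suc n ∷ [] ++ suc n ∷ z ∷ Z) → X ++ suc n ∷ suc n ∷ z ∷ Z ∈ enumQ̄ (suc n)
Z-nonempty-1∉X-case {n} {X} {z} {Z} 1∉X XZ↭ av with doubledSplit 0 n (z ∷ Z) X Z++X≡
  where
  open TopDecomposition {X = X} {[]} {z ∷ Z} XZ↭ av
  1∈Z : 1 ∈ z ∷ Z
  1∈Z with ∈-++⁻ X (∈-resp-↭ (↭-sym XZ↭) (one∈doubledFrom (<-≤-trans (proj₁ (Z-bounds (here refl))) (proj₂ (Z-bounds (here refl))))))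
  ... | inj₁ 1∈X = ⊥-elim (1∉X 1∈X)
  ... | inj₂ 1∈Z = 1∈Z
  ascX : Ascending X
  ascX {a} {b} ab⊆ = ≮⇒≥ λ b<a → X-descent-above-Z ab⊆ b<a 1∈Z
    (≤∧≢⇒< (proj₁ (X-bounds b∈)) λ { refl → 1∉X b∈ })
    where
    b∈ : b ∈ X
    b∈ = to∈ (⊆.∷ˡ⁻ ab⊆)
  Z++X≡ : (z ∷ Z) ++ X ≡ doubledFrom 0 n
  Z++X≡ = ascending-↭⇒≡ (ascending-++ Y++Z-ascending ascX (λ z∈ x∈ → Z≤X x∈ z∈)) (ascending-doubledFrom 0 n)
    (↭-trans (++-comm (z ∷ Z) X) XZ↭)
... | between-pairs (suc j) {c} refl refl refl rewrite sym (doubledFrom-+∸ (suc j) c) =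
  rotationTops∈enumQ̄ (m≤m+n (suc j) c)
... | inside-pair zero refl _ refl = ⊥-elim (1∉X (here refl))
... | inside-pair (suc j) {c} refl refl refl rewrite sym (doubledFrom-+∸ (suc (suc j)) c) =
  brokenPairTops∈enumQ̄ (m≤m+n (suc (suc j)) c)

Z≡[1]-case : ∀ {n X₁ X₂} → (X₁ ++ 1 ∷ X₂) ++ [] ++ [ 1 ] ↭ doubledFrom 0 n →
  AvoidsAll ((X₁ ++ 1 ∷ X₂) ++ suc n ∷ [] ++ suc n ∷ [ 1 ]) →
  (X₁ ++ 1 ∷ X₂) ++ suc n ∷ suc n ∷ [ 1 ] ∈ enumQ̄ (suc n)
Z≡[1]-case {zero} {X₁} X↭ av with () ← ∈-resp-↭ X↭ (∈-++⁺ˡ (∈-++⁺ʳ X₁ (here refl)))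
Z≡[1]-case {suc n} {X₁} {X₂} X↭ av with doubledSplit 1 n X₁ X₂ X₁++X₂≡
  where
  X′ : List ℕ
  X′ = X₁ ++ X₂
  X′↭ : X′ ↭ doubledFrom 1 n
  X′↭ = drop-∷ (drop-∷ (begin
    1 ∷ 1 ∷ X′                ↭⟨ ++⁺ˡ [ 1 ] (↭-sym (shift 1 X₁ X₂)) ⟩
    1 ∷ X₁ ++ 1 ∷ X₂          ↭⟨ ++-comm [ 1 ] (X₁ ++ 1 ∷ X₂) ⟩
    (X₁ ++ 1 ∷ X₂) ++ [ 1 ]   ↭⟨ X↭ ⟩
    doubledFrom 0 (suc n)     ∎))
    where open PermutationReasoning
  X′⊆ : X′ ⊆ X₁ ++ 1 ∷ X₂
  X′⊆ = ⊆.++⁺ ⊆-refl (1 ∷ʳ ⊆-refl)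
  ascX′ : Ascending X′
  ascX′ {a} {b} ab⊆ = ≮⇒≥ λ b<a → AvoidsAll.no321 av
    (a , b , 1 , ⊆.++⁺ (⊆-trans ab⊆ X′⊆) (_ ∷ʳ _ ∷ʳ refl ∷ []) ,
     proj₁ (doubledFrom-bounds 1 n (∈-resp-↭ X′↭ (to∈ (⊆.∷ˡ⁻ ab⊆)))) , b<a)
  X₁++X₂≡ : X′ ≡ doubledFrom 1 n
  X₁++X₂≡ = ascending-↭⇒≡ ascX′ (ascending-doubledFrom 1 n) X′↭
... | between-pairs k {c} refl refl refl rewrite sym (doubledFrom-+∸ (suc k) c) = oneAfterTops∈enumQ̄ (s≤s (m≤m+n k c))
... | inside-pair k refl X₁≡ X₂≡ = ⊥-elim (AvoidsAll.no2121 av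
  (1 , suc (suc k) , ⊆.++⁺ (∈-++-⊆ k+2∈X₁ (refl ∷ from∈ k+2∈X₂)) (_ ∷ʳ _ ∷ʳ refl ∷ []) , s≤s (s≤s z≤n)))
  where
  k+2∈X₁ : suc (suc k) ∈ X₁
  k+2∈X₁ = subst (suc (suc k) ∈_) (sym X₁≡) (∈-++⁺ʳ (doubledFrom 1 k) (here refl))
  k+2∈X₂ : suc (suc k) ∈ X₂
  k+2∈X₂ = subst (suc (suc k) ∈_) (sym X₂≡) (here refl)

Z-nonempty-1∈X-case : ∀ {n X z Z} → 1 ∈ X → X ++ [] ++ z ∷ Z ↭ doubledFrom 0 n →
  AvoidsAll (X ++ suc n ∷ [] ++ suc n ∷ z ∷ Z) → X ++ suc n ∷ suc n ∷ z ∷ Z ∈ enumQ̄ (suc n)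
Z-nonempty-1∈X-case {X = X} {z} {z′ ∷ Z′} 1∈X XZ↭ av =
  ⊥-elim (no-triple XZ↭ (∈-++-⊆ 1∈X (sym (Z-ones 1∈X (here refl)) ∷ sym (Z-ones 1∈X (there (here refl))) ∷ minimum Z′)))
  where open TopDecomposition {X = X} {[]} {z ∷ z′ ∷ Z′} XZ↭ av
Z-nonempty-1∈X-case {X = X} {z} {[]} 1∈X XZ↭ av
  with refl ← TopDecomposition.Z-ones {X = X} {[]} {z ∷ []} XZ↭ av 1∈X (here refl)
     | X₁ , X₂ , refl ← ∈-∃++ 1∈X
  = Z≡[1]-case XZ↭ av

enumQ̄-complete : ∀ n {π} → Q̄ n π → π ∈ enumQ̄ n
enumQ̄-complete zero (π↭ , _) with refl ← ↭-empty-inv π↭ = here refl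
enumQ̄-complete (suc n) (π↭ , av) with top-decomposition π↭
... | X , [] , [] , refl , XYZ↭ =
  appendTops∈enumQ̄ (enumQ̄-complete n (subst (_↭ _) (++-identityʳ X) XYZ↭ , avoidsAll-⊆ (⊆.++⁺ʳ _ ⊆-refl) av))
... | X , _ ∷ _ , [] , refl , XYZ↭ = Y-nonempty-case XYZ↭ av
... | X , _ ∷ _ , _ ∷ _ , refl , XYZ↭ = ⊥-elim (Y-Z-nonempty-impossible XYZ↭ av)
... | X , [] , _ ∷ _ , refl , XYZ↭ with 1 ∈? X
...   | yes 1∈X = Z-nonempty-1∈X-case 1∈X XYZ↭ av
...   | no 1∉X = Z-nonempty-1∉X-case 1∉X XYZ↭ av

brokenPairs-sound : ∀ n → All (Q̄ (suc n)) (brokenPairs n)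
brokenPairs-sound zero = []
brokenPairs-sound (suc n) = All.map⁺ (All.tabulate λ j∈ →
  brokenPairTops-↭ (s≤s (∈-upTo⁻ j∈)) , brokenPairTops-avoidsAll (s≤s (∈-upTo⁻ j∈)))

enumQ̄-sound : ∀ n → All (Q̄ n) (enumQ̄ n)
enumQ̄-sound zero = (↭-refl , avoidsAll-[]) ∷ []
enumQ̄-sound (suc n) =
  All.++⁺ (All.map⁺ (All.map appendTops-Q̄ (enumQ̄-sound n)))
  (All.++⁺ (family (λ j<n → rotationTops-↭ j<n , rotationTops-avoidsAll j<n))
  (All.++⁺ (family (λ j<n → rotationSplitTops-↭ j<n , rotationSplitTops-avoidsAll j<n))
  (All.++⁺ (family (λ i<n → oneAfterTops-↭ i<n , oneAfterTops-avoidsAll i<n)) (brokenPairs-sound n))))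
  where
  family : ∀ {f} → (∀ {j} → j < n → Q̄ (suc n) (f j)) → All (Q̄ (suc n)) (map f (upTo n))
  family f-Q̄ = All.map⁺ (All.tabulate (λ j∈ → f-Q̄ (∈-upTo⁻ j∈)))

∈enumQ̄⇔Q̄ : ∀ n π → π ∈ enumQ̄ n ⇔ Q̄ n π
∈enumQ̄⇔Q̄ n π = mk⇔ (All.lookup (enumQ̄-sound n)) (enumQ̄-complete n)

-- Distinctness

ends : List ℕ → ℕ × ℕ
ends = foldl (λ acc x → proj₂ acc , x) (0 , 0)

ends-++ : ∀ xs y y′ ys → ends (xs ++ y ∷ y′ ∷ ys) ≡ ends (y ∷ y′ ∷ ys)
ends-++ xs y y′ ys = foldl-++ (λ acc x → proj₂ acc , x) (0 , 0) xs (y ∷ y′ ∷ ys)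

ends-low : ∀ j → ends (low j) ≡ (suc j , suc j)
ends-low j = trans (cong ends (doubledFrom-snoc 0 j)) (ends-++ (doubledFrom 0 j) (suc j) (suc j) [])

ends-low-++ : ∀ j x → ends (low j ++ [ x ]) ≡ (suc j , x)
ends-low-++ j x = begin
  ends (low j ++ [ x ])                                   ≡⟨ cong (λ w → ends (w ++ [ x ])) (doubledFrom-snoc 0 j) ⟩
  ends ((doubledFrom 0 j ++ suc j ∷ suc j ∷ []) ++ [ x ]) ≡⟨ cong ends (++-assoc (doubledFrom 0 j) _ [ x ]) ⟩
  ends (doubledFrom 0 j ++ suc j ∷ suc j ∷ [ x ])         ≡⟨ ends-++ (doubledFrom 0 j) (suc j) (suc j) [ x ] ⟩
  (suc j , x)                                             ∎
  where open ≡-Reasoning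

ends-appendTops : ∀ n X → ends (appendTops n X) ≡ (suc n , suc n)
ends-appendTops n X = ends-++ X (suc n) (suc n) []

ends-rotationTops : ∀ n j → ends (rotationTops n j) ≡ (suc j , suc j)
ends-rotationTops n j =
  trans (ends-++ (high n j) (suc n) (suc n) (low j)) (trans (ends-++ (suc n ∷ suc n ∷ []) 1 1 (doubledFrom 1 j)) (ends-low j))

ends-rotationSplitTops : ∀ n j → ends (rotationSplitTops n j) ≡ (suc j , suc n)
ends-rotationSplitTops n j =
  trans (ends-++ (high n j) (suc n) 1 _) (trans (ends-++ [ suc n ] 1 1 (doubledFrom 1 j ++ [ suc n ])) (ends-low-++ j (suc n)))

ends-oneAfterTops : ∀ n i → ends (oneAfterTops n i) ≡ (suc n , 1)
ends-oneAfterTops n i = ends-++ (doubledFrom 1 i ++ 1 ∷ high n i) (suc n) (suc n) [ 1 ]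

ends-brokenPairTops : ∀ n j → ends (brokenPairTops n j) ≡ (suc j , suc (suc j))
ends-brokenPairTops n j =
  trans (ends-++ (suc (suc j) ∷ doubledFrom (suc (suc j)) (n ∸ suc (suc j))) (suc n) (suc n) (low j ++ [ suc (suc j) ]))
    (trans (ends-++ (suc n ∷ suc n ∷ []) 1 1 (doubledFrom 1 j ++ [ suc (suc j) ])) (ends-low-++ j (suc (suc j))))

-- The five families of enumQ̄ (suc n) end in m m, p p, p m, m 1 and p (p + 1) respectively,
-- where m = suc n and p < m.
data EndShape : Set where
  topTop lowTop topLow lowEqual lowDistinct : EndShape

endShape : ℕ → ℕ × ℕ → EndShape
endShape m (p , q) with p ≟ m | q ≟ m | p ≟ q
... | yes _ | yes _ | _     = topTop
... | no _  | yes _ | _     = lowTop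
... | yes _ | no _  | _     = topLow
... | no _  | no _  | yes _ = lowEqual
... | no _  | no _  | no _  = lowDistinct

endShape-topTop : ∀ m → endShape m (m , m) ≡ topTop
endShape-topTop m with m ≟ m
... | yes _ = refl
... | no m≢m = ⊥-elim (m≢m refl)

endShape-lowTop : ∀ {m p} → p ≢ m → endShape m (p , m) ≡ lowTop
endShape-lowTop {m} {p} p≢m with p ≟ m | m ≟ m
... | yes p≡m | _ = ⊥-elim (p≢m p≡m)
... | no _ | yes _ = refl
... | no _ | no m≢m = ⊥-elim (m≢m refl)

endShape-topLow : ∀ {m q} → q ≢ m → endShape m (m , q) ≡ topLow
endShape-topLow {m} {q} q≢m with m ≟ m | q ≟ m
... | _ | yes q≡m = ⊥-elim (q≢m q≡m)
... | yes _ | no _ = refl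
... | no m≢m | no _ = ⊥-elim (m≢m refl)

endShape-lowEqual : ∀ {m p} → p ≢ m → endShape m (p , p) ≡ lowEqual
endShape-lowEqual {m} {p} p≢m with p ≟ m | p ≟ p
... | yes p≡m | _ = ⊥-elim (p≢m p≡m)
... | no _ | yes _ = refl
... | no _ | no p≢p = ⊥-elim (p≢p refl)

endShape-lowDistinct : ∀ {m p q} → p ≢ m → q ≢ m → p ≢ q → endShape m (p , q) ≡ lowDistinct
endShape-lowDistinct {m} {p} {q} p≢m q≢m p≢q with p ≟ m | q ≟ m | p ≟ q
... | yes p≡m | _ | _ = ⊥-elim (p≢m p≡m)
... | _ | yes q≡m | _ = ⊥-elim (q≢m q≡m)
... | no _ | no _ | yes p≡q = ⊥-elim (p≢q p≡q)
... | no _ | no _ | no _ = refl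

HasEndShape : ℕ → EndShape → List ℕ → Set
HasEndShape m s π = endShape m (ends π) ≡ s

other-shape : ∀ {m s s′ ys} → s′ ≢ s → All (HasEndShape m s′) ys → All (λ π → ¬ HasEndShape m s π) ys
other-shape s′≢s = All.map (λ s′-shaped s-shaped → s′≢s (trans (sym s′-shaped) s-shaped))

unique-++-by-shape : ∀ {m s xs ys} → Unique xs → Unique ys →
  All (HasEndShape m s) xs → All (λ π → ¬ HasEndShape m s π) ys → Unique (xs ++ ys)
unique-++-by-shape uxs uys xs-shaped ys-not-shaped =
  Unique.++⁺ uxs uys (λ (v∈xs , v∈ys) → All.lookup ys-not-shaped v∈ys (All.lookup xs-shaped v∈xs))

injective-via-ends : ∀ (f : ℕ → List ℕ) → (∀ j → proj₁ (ends (f j)) ≡ suc j) → ∀ {j j′} → f j ≡ f j′ → j ≡ j′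
injective-via-ends f ends-f {j} {j′} fj≡fj′ =
  suc-injective (trans (sym (ends-f j)) (trans (cong (λ w → proj₁ (ends w)) fj≡fj′) (ends-f j′)))

doubledFrom-++-one-injective : ∀ a i i′ {xs ys} →
  doubledFrom (suc a) i ++ 1 ∷ xs ≡ doubledFrom (suc a) i′ ++ 1 ∷ ys → i ≡ i′
doubledFrom-++-one-injective a zero zero _ = refl
doubledFrom-++-one-injective a zero (suc i′) e with () ← ∷-injectiveˡ e
doubledFrom-++-one-injective a (suc i) zero e with () ← ∷-injectiveˡ e
doubledFrom-++-one-injective a (suc i) (suc i′) e =
  cong suc (doubledFrom-++-one-injective (suc a) i i′ (∷-injectiveʳ (∷-injectiveʳ e)))

upTo-shapes : ∀ {m k s} (f : ℕ → List ℕ) → (∀ {j} → j < k → HasEndShape m s (f j)) →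
  All (HasEndShape m s) (map f (upTo k))
upTo-shapes f f-shaped = All.map⁺ (All.tabulate (λ j∈ → f-shaped (∈-upTo⁻ j∈)))

appendTops-shapes : ∀ n → All (HasEndShape (suc n) topTop) (map (appendTops n) (enumQ̄ n))
appendTops-shapes n =
  All.map⁺ (All.tabulate λ {X} _ → trans (cong (endShape (suc n)) (ends-appendTops n X)) (endShape-topTop (suc n)))

rotationTops-shapes : ∀ n → All (HasEndShape (suc n) lowEqual) (map (rotationTops n) (upTo n))
rotationTops-shapes n = upTo-shapes (rotationTops n) λ {j} j<n →
  trans (cong (endShape (suc n)) (ends-rotationTops n j)) (endShape-lowEqual (<⇒≢ (s≤s j<n)))

rotationSplitTops-shapes : ∀ n → All (HasEndShape (suc n) lowTop) (map (rotationSplitTops n) (upTo n))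
rotationSplitTops-shapes n = upTo-shapes (rotationSplitTops n) λ {j} j<n →
  trans (cong (endShape (suc n)) (ends-rotationSplitTops n j)) (endShape-lowTop (<⇒≢ (s≤s j<n)))

oneAfterTops-shapes : ∀ n → All (HasEndShape (suc n) topLow) (map (oneAfterTops n) (upTo n))
oneAfterTops-shapes n = upTo-shapes (oneAfterTops n) λ {i} i<n →
  trans (cong (endShape (suc n)) (ends-oneAfterTops n i)) (endShape-topLow (<⇒≢ (s≤s (≤-trans (s≤s z≤n) i<n))))

brokenPairs-shapes : ∀ n → All (HasEndShape (suc n) lowDistinct) (brokenPairs n)
brokenPairs-shapes zero = []
brokenPairs-shapes (suc n) = upTo-shapes (brokenPairTops (suc n)) λ {j} j<n →
  trans (cong (endShape _) (ends-brokenPairTops (suc n) j))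
    (endShape-lowDistinct (<⇒≢ (s≤s (<-trans j<n (n<1+n n)))) (<⇒≢ (s≤s (s≤s j<n))) (<⇒≢ (n<1+n (suc j))))

rotationTops-unique : ∀ n → Unique (map (rotationTops n) (upTo n))
rotationTops-unique n =
  Unique.map⁺ (injective-via-ends (rotationTops n) (λ j → cong proj₁ (ends-rotationTops n j))) (Unique.upTo⁺ n)

rotationSplitTops-unique : ∀ n → Unique (map (rotationSplitTops n) (upTo n))
rotationSplitTops-unique n =
  Unique.map⁺ (injective-via-ends (rotationSplitTops n) (λ j → cong proj₁ (ends-rotationSplitTops n j))) (Unique.upTo⁺ n)

oneAfterTops-unique : ∀ n → Unique (map (oneAfterTops n) (upTo n))
oneAfterTops-unique n =
  Unique.map⁺ (λ e → doubledFrom-++-one-injective 0 _ _ (++-cancelʳ (suc n ∷ suc n ∷ [ 1 ]) _ _ e)) (Unique.upTo⁺ n)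

brokenPairs-unique : ∀ n → Unique (brokenPairs n)
brokenPairs-unique zero = []
brokenPairs-unique (suc n) =
  Unique.map⁺ (injective-via-ends (brokenPairTops (suc n)) (λ j → cong proj₁ (ends-brokenPairTops (suc n) j))) (Unique.upTo⁺ n)

enumQ̄-unique : ∀ n → Unique (enumQ̄ n)
enumQ̄-unique zero = [] ∷ []
enumQ̄-unique (suc n) =
  unique-++-by-shape (Unique.map⁺ (++-cancelʳ _ _ _) (enumQ̄-unique n)) uniqueB+ (appendTops-shapes n)
    (All.++⁺ (other-shape (λ ()) (rotationTops-shapes n)) notTopTopC+)
  where
  notTopTopC+ : All (λ π → ¬ HasEndShape (suc n) topTop π)
                    (map (rotationSplitTops n) (upTo n) ++ map (oneAfterTops n) (upTo n) ++ brokenPairs n)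
  notTopTopC+ = All.++⁺ (other-shape (λ ()) (rotationSplitTops-shapes n))
    (All.++⁺ (other-shape (λ ()) (oneAfterTops-shapes n)) (other-shape (λ ()) (brokenPairs-shapes n)))
  uniqueE+ : Unique (map (oneAfterTops n) (upTo n) ++ brokenPairs n)
  uniqueE+ = unique-++-by-shape (oneAfterTops-unique n) (brokenPairs-unique n)
    (oneAfterTops-shapes n) (other-shape (λ ()) (brokenPairs-shapes n))
  uniqueC+ : Unique (map (rotationSplitTops n) (upTo n) ++ map (oneAfterTops n) (upTo n) ++ brokenPairs n)
  uniqueC+ = unique-++-by-shape (rotationSplitTops-unique n) uniqueE+ (rotationSplitTops-shapes n)
    (All.++⁺ (other-shape (λ ()) (oneAfterTops-shapes n)) (other-shape (λ ()) (brokenPairs-shapes n)))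
  uniqueB+ : Unique (map (rotationTops n) (upTo n) ++ map (rotationSplitTops n) (upTo n) ++
                     map (oneAfterTops n) (upTo n) ++ brokenPairs n)
  uniqueB+ = unique-++-by-shape (rotationTops-unique n) uniqueC+ (rotationTops-shapes n)
    (All.++⁺ (other-shape (λ ()) (rotationSplitTops-shapes n))
      (All.++⁺ (other-shape (λ ()) (oneAfterTops-shapes n)) (other-shape (λ ()) (brokenPairs-shapes n))))

-- Counting

length-map-upTo : ∀ (f : ℕ → List ℕ) n → length (map f (upTo n)) ≡ n
length-map-upTo f n = trans (length-map f (upTo n)) (length-upTo n)

length-map-upTo-++ : ∀ (f : ℕ → List ℕ) n {ys} → length (map f (upTo n) ++ ys) ≡ n + length ys
length-map-upTo-++ f n {ys} = trans (length-++ (map f (upTo n))) (cong (_+ length ys) (length-map-upTo f n))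

length-enumQ̄-suc : ∀ n → length (enumQ̄ (suc n)) ≡ length (enumQ̄ n) + (n + (n + (n + length (brokenPairs n))))
length-enumQ̄-suc n =
  trans (length-++ (map (appendTops n) (enumQ̄ n)))
    (cong₂ _+_ (length-map (appendTops n) (enumQ̄ n))
      (trans (length-map-upTo-++ (rotationTops n) n)
        (cong (n +_) (trans (length-map-upTo-++ (rotationSplitTops n) n)
          (cong (n +_) (length-map-upTo-++ (oneAfterTops n) n))))))

rearrange : ∀ L n → L + (suc n + (suc n + (suc n + n))) + 3 * suc (suc n) ≡ (L + 3 * suc n) + (4 * n + 6)
rearrange = solve-∀

-- x ^ 2 unfolds to x * (x * 1); the ring solver needs it in that form.
square-step : ∀ n → 2 * (suc n * (suc n * 1)) + 2 + (4 * n + 6) ≡ 2 * (suc (suc n) * (suc (suc n) * 1)) + 2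
square-step = solve-∀

length-enumQ̄ : ∀ {n} → 0 < n → length (enumQ̄ n) + 3 * n ≡ 2 * n ^ 2 + 2
length-enumQ̄ {suc zero} _ = refl
length-enumQ̄ {suc (suc n)} _ = begin
  length (enumQ̄ (suc (suc n))) + 3 * suc (suc n)
    ≡⟨ cong (_+ 3 * suc (suc n)) (length-enumQ̄-suc (suc n)) ⟩
  L + (suc n + (suc n + (suc n + length (brokenPairs (suc n))))) + 3 * suc (suc n)
    ≡⟨ cong (λ g → L + (suc n + (suc n + (suc n + g))) + 3 * suc (suc n)) (length-map-upTo (brokenPairTops (suc n)) n) ⟩
  L + (suc n + (suc n + (suc n + n))) + 3 * suc (suc n)
    ≡⟨ rearrange L n ⟩
  (L + 3 * suc n) + (4 * n + 6)
    ≡⟨ cong (_+ (4 * n + 6)) (length-enumQ̄ {suc n} (s≤s z≤n)) ⟩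
  2 * suc n ^ 2 + 2 + (4 * n + 6)
    ≡⟨ square-step n ⟩
  2 * suc (suc n) ^ 2 + 2 ∎
  where
  open ≡-Reasoning
  L : ℕ
  L = length (enumQ̄ (suc n))

square-excess : ∀ k → 2 * (suc (suc k) * (suc (suc k) * 1)) ≡ 3 * suc (suc k) + (2 * k * k + 5 * k + 2)
square-excess = solve-∀

count-closed-form : ∀ {n L} → 2 ≤ n → L + 3 * n ≡ 2 * n ^ 2 + 2 → L ≡ 2 * n ^ 2 ∸ 3 * n + 2
count-closed-form {n@(suc (suc k))} {L} (s≤s (s≤s z≤n)) L+3n≡ = begin
  L                     ≡⟨ sym (m+n∸n≡m L (3 * n)) ⟩
  L + 3 * n ∸ 3 * n     ≡⟨ cong (_∸ 3 * n) L+3n≡ ⟩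
  2 * n ^ 2 + 2 ∸ 3 * n ≡⟨ +-∸-comm 2 3n≤2n² ⟩
  2 * n ^ 2 ∸ 3 * n + 2 ∎
  where
  open ≡-Reasoning
  3n≤2n² : 3 * n ≤ 2 * n ^ 2
  3n≤2n² = subst (3 * n ≤_) (sym (square-excess k)) (m≤m+n (3 * n) _)

theorem4p7 : (n : ℕ) → 2 ≤ n →
    HasCount (QAvoid n ((1 ∷ 3 ∷ 2 ∷ []) ∷ (3 ∷ 2 ∷ 1 ∷ []) ∷ []))
             (2 * n ^ 2 ∸ 3 * n + 2)
theorem4p7 n 2≤n =
  enumQ̄ n ,
  enumQ̄-unique n ,
  (λ π → ⇔.trans (∈enumQ̄⇔Q̄ n π) (⇔.sym (QAvoid⇔Q̄ n π))) ,
  count-closed-form 2≤n (length-enumQ̄ (<-trans (s≤s z≤n) 2≤n))
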